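{- Let $\mathcal{Y}$ be an alignment of $P$ onto a fragment $T[t..t')$ of cost at most $k$. If $|\tau_i^0-t-\pi_0^0|>w+2k$ holds for every $i\in[0..n_0-m_0]$, then $\mathrm{bc}(\mathbf{G}_{S\cup\{\mathcal{Y}\}})\le\mathrm{bc}(\mathbf{G}_S)/2$.
   Context: Notation: $[i..j]=\{i,\dots,j\}$, $[i..j)=\{i,\dots,j-1\}$; $X[i..j)=X[i]\cdots X[j-1]$. An alignment of $X[x..x')$ onto $Y[y..y')$ is a sequence $(x_t,y_t)_{t=0}^{\ell}$ from $(x,y)$ to $(x',y')$ with steps $(+1,+1)$ (aligns $X[x_t]$ with $Y[y_t]$; a match if equal, a substitution otherwise), $(+1,0)$ (deletes $X[x_t]$), $(0,+1)$ (inserts $Y[y_t]$); its cost is the number of insertions, deletions and substitutions; $\delta_E$ is the minimum cost (edit distance). Fix $k$ and strings $P,T$, and a set $S$ of alignments of $P$ onto fragments of $T$, each of cost at most $k$. The graph $\mathbf{G}_S$ has one vertex per character of $P$, one per character of $T$, and a special vertex $\bot$; for each alignment in $S$ it has an edge $\{P[x],\bot\}$ for each deleted $P[x]$, $\{\bot,T[y]\}$ for each inserted $T[y]$, and $\{P[x],T[y]\}$ for each aligned pair; an edge is black if the pair is matched and red otherwise. A component is red if it has a red edge, black otherwise; $\mathrm{bc}(\mathbf{G}_S)$ is the number of black components. Assume $S$ encloses $T$, i.e., $|T|\le 2|P|-2k$ and $S$ contains alignments $\mathcal{X}_{\mathrm{pref}}\ni(0,0)$ and $\mathcal{X}_{\mathrm{suf}}\ni(|P|,|T|)$,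 and assume $\mathrm{bc}(\mathbf{G}_S)>0$. Let $P_{|S}$ ($T_{|S}$) be the subsequence of characters of $P$ ($T$) lying in black components. For every $c\in[0..\mathrm{bc}(\mathbf{G}_S))$ there is a black component (the $c$-th black component) consisting exactly of the characters $P_{|S}[i]$ and $T_{|S}[i]$ with $i\equiv c \pmod{\mathrm{bc}(\mathbf{G}_S)}$, and the last characters of $P_{|S}$ and $T_{|S}$ lie in the same component, with index $c_{\mathrm{last}}$. Let $m_c=\lceil(|P_{|S}|-c)/\mathrm{bc}(\mathbf{G}_S)\rceil$, $n_c=\lceil(|T_{|S}|-c)/\mathrm{bc}(\mathbf{G}_S)\rceil$, $\pi_j^c$ ($j\in[0..m_c)$) the position in $P$ of $P_{|S}[c+j\,\mathrm{bc}(\mathbf{G}_S)]$, and $\tau_i^c$ ($i\in[0..n_c)$) the position in $T$ of $T_{|S}[c+i\,\mathrm{bc}(\mathbf{G}_S)]$; by convention, with $b=\mathrm{bc}(\mathbf{G}_S)$, $m_b=m_0-1$, $\pi_j^b=\pi_{j+1}^0$, $n_b=n_0-1$, $\tau_i^b=\tau_{i+1}^0$. A weight function $w_S:[0..b)\to\mathbb{Z}_{\ge0}$ covers $S$ if: (1) $w_S(c)\ge\delta_E(P[\pi_j^c..\pi_j^{c+1}),T[\tau_i^c..\tau_i^{c+1}))$ for all $c\in[0..b)$, $j\in[0..m_{c+1})$, $i\in[0..n_{c+1})$; (2) $w_S(b-1)\ge\delta_E(P[0..\pi_0^0),T[0..\tau_0^0))$; (3) for every $i\in[1..n_0)$ some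 $t\in[\tau_{i-1}^{b-1}..\tau_i^0]$ satisfies $w_S(b-1)\ge\delta_E(P[0..\pi_0^0),T[t..\tau_i^0))$; (4) $w_S(c_{\mathrm{last}})\ge\delta_E(P[\pi_{m_0-1}^{c_{\mathrm{last}}}..|P|),T[\tau_{n_0-1}^{c_{\mathrm{last}}}..|T|))$; (5) for every $i\in[0..n_0-1)$ some $t'\in[\tau_i^{c_{\mathrm{last}}}..\tau_i^{c_{\mathrm{last}}+1}]$ satisfies $w_S(c_{\mathrm{last}})\ge\delta_E(P[\pi_{m_0-1}^{c_{\mathrm{last}}}..|P|),T[\tau_i^{c_{\mathrm{last}}}..t'))$. Fix such a covering $w_S$ with total weight $\sum_c w_S(c)\le w$. -}

module Defs where

open import Data.Nat using (ℕ; zero; suc; _+_; _*_; _∸_; _≤_; _<_; NonZero)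
open import Data.Nat.DivMod using (_/_; _%_)
open import Data.Unit using (⊤)
open import Data.Bool using (Bool; true; false)
open import Data.Maybe using (Maybe; just; nothing)
open import Data.List using (List; []; _∷_; length; concatMap; map; upTo)
open import Data.List.Membership.Propositional using (_∈_)
open import Data.List.Relation.Unary.AllPairs using (AllPairs)
open import Data.Product using (Σ; _×_; _,_; ∃)
open import Data.Sum using (_⊎_)
open import Relation.Nullary using (¬_; does)
open import Relation.Binary.Definitions using (DecidableEquality)
open import Relation.Binary.PropositionalEquality using (_≡_; _≢_)
open import Relation.Binary.Construct.Closure.ReflexiveTransitive using (Star)

at : {A : Set} → List A → ℕ → Maybe A
at []       _       = nothing
at (a ∷ _)  zero    = just a
at (_ ∷ as) (suc i) = at as i

matchB : {A : Set} → DecidableEquality A → Maybe A → Maybe A → Bool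
matchB _≟_ (just a) (just b) = does (a ≟ b)
matchB _   _        _        = false

-- diag : (+1,+1) step (match or substitution), del : (+1,0), ins : (0,+1)
data Step : Set where
  diag del ins : Step

-- An alignment is given by its starting point (x_0,y_0) and its steps;
-- the point sequence (x_t,y_t) is obtained by applying the steps.
record Alignment : Set where
  constructor mkAl
  field
    sx    : ℕ
    sy    : ℕ
    steps : List Step
open Alignment public

dX : List Step → ℕ
dX []           = 0
dX (diag ∷ ss)  = suc (dX ss)
dX (del  ∷ ss)  = suc (dX ss)
dX (ins  ∷ ss)  = dX ss

dY : List Step → ℕ
dY []           = 0
dY (diag ∷ ss)  = suc (dY ss)
dY (del  ∷ ss)  = dY ss
dY (ins  ∷ ss)  = suc (dY ss)

ex : Alignment → ℕ
ex a = sx a + dX (steps a)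

ey : Alignment → ℕ
ey a = sy a + dY (steps a)

costFrom : {A : Set} → DecidableEquality A → List A → List A → ℕ → ℕ → List Step → ℕ
costFrom eq X Y x y []          = 0
costFrom eq X Y x y (diag ∷ ss) with matchB eq (at X x) (at Y y)
... | true  = costFrom eq X Y (suc x) (suc y) ss
... | false = suc (costFrom eq X Y (suc x) (suc y) ss)
costFrom eq X Y x y (del ∷ ss)  = suc (costFrom eq X Y (suc x) y ss)
costFrom eq X Y x y (ins ∷ ss)  = suc (costFrom eq X Y x (suc y) ss)

cost : {A : Set} → DecidableEquality A → List A → List A → Alignment → ℕ
cost eq X Y a = costFrom eq X Y (sx a) (sy a) (steps a)

AlignsFrag : Alignment → ℕ → ℕ → ℕ → ℕ → Set
AlignsFrag a x x' y y' = (sx a ≡ x × ex a ≡ x') × (sy a ≡ y × ey a ≡ y')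

-- δ_E(X[x..x'), Y[y..y')) ≤ d : the minimum cost of an alignment of
-- X[x..x') onto Y[y..y') is at most d, i.e. some such alignment costs ≤ d.
EDle : {A : Set} → DecidableEquality A →
       List A → ℕ → ℕ → List A → ℕ → ℕ → ℕ → Set
EDle eq X x x' Y y y' d =
  Σ Alignment λ a → AlignsFrag a x x' y y' × cost eq X Y a ≤ d

-- a is an alignment of P onto a fragment T[t..t') of cost at most k
-- (t ≤ t' is automatic).
AlignPT : {A : Set} → DecidableEquality A →
          ℕ → List A → List A → ℕ → ℕ → Alignment → Set
AlignPT eq k P T t t' a =
  AlignsFrag a 0 (length P) t t' × t' ≤ length T × cost eq P T a ≤ k

data Vertex : Set where
  pv  : ℕ → Vertex
  tv  : ℕ → Vertex
  bot : Vertex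

-- an edge {u,v} with its colour (true = black, i.e. matched pair)
record Edge : Set where
  constructor edge
  field
    end₁  : Vertex
    end₂  : Vertex
    black : Bool
open Edge public

edgesFrom : {A : Set} → DecidableEquality A → List A → List A → ℕ → ℕ → List Step → List Edge
edgesFrom eq P T x y []          = []
edgesFrom eq P T x y (diag ∷ ss) =
  edge (pv x) (tv y) (matchB eq (at P x) (at T y)) ∷ edgesFrom eq P T (suc x) (suc y) ss
edgesFrom eq P T x y (del ∷ ss)  =
  edge (pv x) bot false ∷ edgesFrom eq P T (suc x) y ss
edgesFrom eq P T x y (ins ∷ ss)  =
  edge bot (tv y) false ∷ edgesFrom eq P T x (suc y) ss

alignmentEdges : {A : Set} → DecidableEquality A → List A → List A → Alignment → List Edge
alignmentEdges eq P T a = edgesFrom eq P T (sx a) (sy a) (steps a)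

graphEdges : {A : Set} → DecidableEquality A → List A → List A → List Alignment → List Edge
graphEdges eq P T S = concatMap (alignmentEdges eq P T) S

IsVertex : {A : Set} → List A → List A → Vertex → Set
IsVertex P T (pv x) = x < length P
IsVertex P T (tv y) = y < length T
IsVertex P T bot    = ⊤

Adj : List Edge → Vertex → Vertex → Set
Adj E u v = ∃ λ b → (edge u v b ∈ E) ⊎ (edge v u b ∈ E)

Conn : List Edge → Vertex → Vertex → Set
Conn E = Star (Adj E)

-- v lies in a black component: the component of v has no red edge.
-- (The component of ⊥ is never counted as black.)
InBlack : List Edge → Vertex → Set
InBlack E v = v ≢ bot × (∀ u u' → edge u u' false ∈ E → ¬ Conn E v u)

-- bc(G) = n : there are exactly n black components, witnessed by a list
-- of n pairwise non-connected black vertices meeting every black component.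
BC : {A : Set} → List A → List A → List Edge → ℕ → Set
BC P T E n = Σ (List Vertex) λ reps →
    length reps ≡ n
  × (∀ r → r ∈ reps → IsVertex P T r × InBlack E r)
  × AllPairs (λ u v → ¬ Conn E u v) reps
  × (∀ v → IsVertex P T v → InBlack E v → ∃ λ r → r ∈ reps × Conn E v r)

-- P_{|S}, T_{|S} as increasing lists of positions

BlackPositionsP : {A : Set} → List A → List A → List Edge → List ℕ → Set
BlackPositionsP P T E ps =
  AllPairs _<_ ps × (∀ x → (x ∈ ps → x < length P × InBlack E (pv x))
                         × (x < length P × InBlack E (pv x) → x ∈ ps))

BlackPositionsT : {A : Set} → List A → List A → List Edge → List ℕ → Set
BlackPositionsT P T E ts =
  AllPairs _<_ ts × (∀ y → (y ∈ ts → y < length T × InBlack E (tv y))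
                         × (y < length T × InBlack E (tv y) → y ∈ ts))

-- i-th element of a list (0 if out of range; never used out of range)
nth : List ℕ → ℕ → ℕ
nth []       _       = 0
nth (x ∷ _)  zero    = x
nth (_ ∷ xs) (suc i) = nth xs i

-- ⌈ L / b ⌉ (b > 0; value 0 for b = 0, never used)
ceilDiv : ℕ → ℕ → ℕ
ceilDiv L zero    = 0
ceilDiv L (suc b) = (L + b) / suc b

-- π_j^c (resp. τ_i^c) for the list ps = P_{|S} (resp. ts = T_{|S}) and b = bc:
-- position of the (c + j·b)-th element.  For c = b this is exactly the
-- convention π_j^b = π_{j+1}^0.
posAt : List ℕ → ℕ → ℕ → ℕ → ℕ
posAt ps b c j = nth ps (c + j * b)

-- m_c = ⌈(|P_{|S}| - c)/b⌉ (resp. n_c); for c = b this equals m_0 - 1.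
cnt : List ℕ → ℕ → ℕ → ℕ
cnt ps b c = ceilDiv (length ps ∸ c) b

-- c_last : index of the black component of the last character of P_{|S}
cLast : List ℕ → ℕ → ℕ
cLast ps zero    = 0
cLast ps (suc b) = (length ps ∸ 1) % suc b

record Covers {A : Set} (eq : DecidableEquality A) (P T : List A)
              (b : ℕ) (ps ts : List ℕ) (wS : ℕ → ℕ) : Set where
  private
    π : ℕ → ℕ → ℕ
    π = posAt ps b
    τ : ℕ → ℕ → ℕ
    τ = posAt ts b
    m : ℕ → ℕ
    m = cnt ps b
    n : ℕ → ℕ
    n = cnt ts b
    cl : ℕ
    cl = cLast ps b
  field
    cover1 : ∀ c → c < b → ∀ j → j < m (suc c) → ∀ i → i < n (suc c) →
             EDle eq P (π c j) (π (suc c) j) T (τ c i) (τ (suc c) i) (wS c)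
    cover2 : EDle eq P 0 (π 0 0) T 0 (τ 0 0) (wS (b ∸ 1))
    cover3 : ∀ i → 1 ≤ i → i < n 0 →
             Σ ℕ λ t → τ (b ∸ 1) (i ∸ 1) ≤ t × t ≤ τ 0 i ×
               EDle eq P 0 (π 0 0) T t (τ 0 i) (wS (b ∸ 1))
    cover4 : EDle eq P (π cl (m 0 ∸ 1)) (length P) T (τ cl (n 0 ∸ 1)) (length T) (wS cl)
    cover5 : ∀ i → i < n 0 ∸ 1 →
             Σ ℕ λ t' → τ cl i ≤ t' × t' ≤ τ (suc cl) i ×
               EDle eq P (π cl (m 0 ∸ 1)) (length P) T (τ cl i) t' (wS cl)

{-# OPTIONS --safe #-}
-- Write b = bc(G_S). An alignment in S only matches black characters with black ones, so it
-- aligns P_{|S}[j] with T_{|S}[j + s] for a fixed shift s. The prefix alignment has shift 0 and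
-- the suffix one shift d = |T_{|S}| - |P_{|S}| ≤ |P_{|S}| (by enclosure), so the black
-- components are the residue classes of these indices modulo the gcd of the shifts (modulo
-- |P_{|S}| if d = 0), and counting representatives identifies that modulus with b.
-- Adding Y only merges old components. If a new black component met a single old class c,
-- then Y would align each P_{|S}[c + jb] with a class-c character of T_{|S}, the images being
-- at least b apart; so the first one is T_{|S}[c + ib] with i + m_0 ≤ n_0. Telescoping the
-- covering bounds over the classes 0, ..., c-1 and adding the cost of Y gives
-- |τ_i^0 - t - π_0^0| ≤ w + k, against the hypothesis. Hence every new black component
-- contains two old ones.

module Submission where

open import Defs
open import Data.Bool using (Bool; true; false)
open import Data.Empty using (⊥; ⊥-elim)
open import Data.Fin as Fin using (Fin; zero; suc; toℕ; splitAt; join)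
import Data.Fin.Properties as Fin
open import Data.Integer as ℤ using (ℤ; +_; _-_; ∣_∣)
import Data.Integer.Properties as ℤ
open import Data.Integer.Tactic.RingSolver using (solve-∀)
open import Data.List using (List; []; _∷_; [_]; _∷ʳ_; length; lookup; foldr; map; upTo)
open import Data.List.Properties using (upTo-∷ʳ; map-++)
open import Data.List.Membership.Propositional using (_∈_; _∉_; find)
open import Data.List.Membership.Propositional.Properties using (∈-concatMap⁺; ∈-concatMap⁻; ∈-lookup)
open import Data.List.Relation.Binary.Subset.Propositional using (_⊆_)
open import Data.List.Relation.Binary.Subset.Propositional.Properties using (xs⊆xs++ys; xs⊆ys++xs)
open import Data.List.Relation.Unary.All as All using (All; []; _∷_)
open import Data.List.Relation.Unary.AllPairs using (AllPairs; []; _∷_)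
open import Data.List.Relation.Unary.Any as Any using (here; there; index)
open import Data.List.Relation.Unary.Any.Properties using (lookup-index)
open import Data.Nat hiding (∣_-_∣)
open import Data.Nat.Properties
open import Data.List.Membership.DecPropositional _≟_ using (_∈?_)
open import Data.Nat.DivMod
open import Data.Nat.Divisibility using (_∣_; _∣0; divides; ∣-trans; ∣m+n∣m⇒∣n; n∣m*n; 0∣⇒≡0; ∣⇒≤)
open import Data.Nat.GCD using (gcd; gcd-GCD; gcd[m,n]∣m; gcd[m,n]∣n; module Bézout)
open import Data.Nat.ListAction using (sum)
open import Data.Nat.ListAction.Properties using (sum-++)
import Data.Nat.Tactic.RingSolver as ℕ-Solver
open import Data.Product using (Σ; _×_; _,_; proj₁; proj₂)
open import Data.Sum using (_⊎_; inj₁; inj₂)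
open import Function using (id; _∘_; _∘′_)
open import Relation.Nullary using (¬_; yes; no)
open import Relation.Nullary.Decidable using (decidable-stable)
open import Relation.Binary.Definitions using (DecidableEquality)
open import Relation.Binary.PropositionalEquality
  using (_≡_; _≢_; refl; sym; trans; cong; cong₂; subst; subst₂; module ≡-Reasoning)
open import Relation.Binary.Construct.Closure.ReflexiveTransitive as Star using (ε; _◅_; _◅◅_)

-- Arithmetic

sum-upTo-suc : ∀ (f : ℕ → ℕ) n → sum (map f (upTo (suc n))) ≡ sum (map f (upTo n)) + f n
sum-upTo-suc f n = begin
  sum (map f (upTo (suc n)))              ≡⟨ cong (sum ∘ map f) (upTo-∷ʳ n) ⟨
  sum (map f (upTo n ∷ʳ n))               ≡⟨ cong sum (map-++ f (upTo n) [ n ]) ⟩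
  sum (map f (upTo n) ∷ʳ f n)             ≡⟨ sum-++ (map f (upTo n)) [ f n ] ⟩
  sum (map f (upTo n)) + (f n + 0)        ≡⟨ cong (λ x → sum (map f (upTo n)) + x) (+-identityʳ (f n)) ⟩
  sum (map f (upTo n)) + f n              ∎
  where
  open ≡-Reasoning

sum-upTo-mono : ∀ (f : ℕ → ℕ) {m n} → m ≤ n → sum (map f (upTo m)) ≤ sum (map f (upTo n))
sum-upTo-mono f {m} {zero}  z≤n = ≤-refl
sum-upTo-mono f {m} {suc n} m≤1+n with m ≟ suc n
... | yes refl = ≤-refl
... | no  m≢1+n = begin
  sum (map f (upTo m))            ≤⟨ sum-upTo-mono f (≤-pred (≤∧≢⇒< m≤1+n m≢1+n)) ⟩
  sum (map f (upTo n))            ≤⟨ m≤m+n _ (f n) ⟩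
  sum (map f (upTo n)) + f n      ≡⟨ sum-upTo-suc f n ⟨
  sum (map f (upTo (suc n)))      ∎
  where open ≤-Reasoning

∣+m-+n∣≤ : ∀ {m n d} → m ≤ d + n → n ≤ d + m → ∣ + m - + n ∣ ≤ d
∣+m-+n∣≤ {m} {n} {d} m≤d+n n≤d+m rewrite ℤ.m-n≡m⊖n m n with n ≤? m
... | yes n≤m = subst (_≤ d) (sym (cong ∣_∣ (ℤ.⊖-≥ n≤m))) (m≤n+o⇒m∸n≤o m n (subst (m ≤_) (+-comm d n) m≤d+n))
... | no  n≰m = subst (_≤ d) (sym (ℤ.∣⊖∣-< (≰⇒> n≰m))) (m≤n+o⇒m∸n≤o n m (subst (n ≤_) (+-comm d m) n≤d+m))

offset-difference : ∀ x a y b → (+ (x + a) - + x) - (+ (y + b) - + y) ≡ + a - + b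
offset-difference x a y b rewrite ℤ.pos-+ x a | ℤ.pos-+ y b = cancel (+ x) (+ a) (+ y) (+ b)
  where
  cancel : ∀ (x a y b : ℤ) → (x ℤ.+ a - x) - (y ℤ.+ b - y) ≡ a - b
  cancel = solve-∀

telescope : ∀ (D : ℕ → ℤ) (W : ℕ → ℕ) c → (∀ c' → c' < c → ∣ D (suc c') - D c' ∣ ≤ W c') →
  ∣ D c - D 0 ∣ ≤ sum (map W (upTo c))
telescope D W zero    _     = ≤-reflexive (cong ∣_∣ (ℤ.i≡j⇒i-j≡0 {D 0} refl))
telescope D W (suc c) steps = begin
  ∣ D (suc c) - D 0 ∣                              ≡⟨ cong ∣_∣ (split (D (suc c)) (D c) (D 0)) ⟩
  ∣ (D (suc c) - D c) ℤ.+ (D c - D 0) ∣            ≤⟨ ℤ.∣i+j∣≤∣i∣+∣j∣ (D (suc c) - D c) (D c - D 0) ⟩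
  ∣ D (suc c) - D c ∣ + ∣ D c - D 0 ∣              ≤⟨ +-mono-≤ (steps c ≤-refl) (telescope D W c earlier-steps) ⟩
  W c + sum (map W (upTo c))                       ≡⟨ +-comm (W c) _ ⟩
  sum (map W (upTo c)) + W c                       ≡⟨ sum-upTo-suc W c ⟨
  sum (map W (upTo (suc c)))                       ∎
  where
  open ≤-Reasoning
  split : ∀ (x y z : ℤ) → x - z ≡ (x - y) ℤ.+ (y - z)
  split = solve-∀
  earlier-steps : ∀ c' → c' < c → ∣ D (suc c') - D c' ∣ ≤ W c'
  earlier-steps c' c'<c = steps c' (m≤n⇒m≤1+n c'<c)

m%n≡[m+o]%n⇒n∣o : ∀ m o n .{{_ : NonZero n}} → m % n ≡ (m + o) % n → n ∣ o
m%n≡[m+o]%n⇒n∣o m o n eq = ∣m+n∣m⇒∣n (subst (n ∣_) quotients (n∣m*n ((m + o) / n))) (n∣m*n (m / n))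
  where
  open ≡-Reasoning
  quotients : (m + o) / n * n ≡ m / n * n + o
  quotients = +-cancelˡ-≡ (m % n) _ _ (begin
    m % n + (m + o) / n * n       ≡⟨ cong (_+ (m + o) / n * n) eq ⟩
    (m + o) % n + (m + o) / n * n ≡⟨ m≡m%n+[m/n]*n (m + o) n ⟨
    m + o                         ≡⟨ cong (_+ o) (m≡m%n+[m/n]*n m n) ⟩
    m % n + m / n * n + o         ≡⟨ +-assoc (m % n) _ o ⟩
    m % n + (m / n * n + o)       ∎)

%-≡⇒+-≤ : ∀ {m o} n .{{_ : NonZero n}} → m < o → m % n ≡ o % n → m + n ≤ o
%-≡⇒+-≤ {m} {o} n m<o eq with m%n≡[m+o]%n⇒n∣o m (o ∸ m) n (trans eq (cong (_% n) (sym (m+[n∸m]≡n (<⇒≤ m<o)))))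
... | n∣o∸m = begin
  m + n        ≤⟨ +-monoʳ-≤ m (∣⇒≤ {{>-nonZero (m<n⇒0<n∸m m<o)}} n∣o∸m) ⟩
  m + (o ∸ m)  ≡⟨ m+[n∸m]≡n (<⇒≤ m<o) ⟩
  o            ∎
  where open ≤-Reasoning

*<⇒<ceilDiv : ∀ i L n .{{_ : NonZero n}} → i * n < L → i < ceilDiv L n
*<⇒<ceilDiv i L (suc n) i*n<L = begin-strict
  i                               <⟨ n<1+n i ⟩
  suc i                           ≡⟨ m*n/n≡m (suc i) (suc n) ⟨
  suc i * suc n / suc n           ≤⟨ /-monoˡ-≤ (suc n) (begin
      suc i * suc n               ≡⟨ expand i n ⟩
      suc (i * suc n) + n         ≤⟨ +-monoˡ-≤ n i*n<L ⟩
      L + n                       ∎) ⟩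
  (L + n) / suc n                 ∎
  where
  open ≤-Reasoning
  expand : ∀ i n → suc i * suc n ≡ suc (i * suc n) + n
  expand = ℕ-Solver.solve-∀

ceilDiv-+* : ∀ L e n .{{_ : NonZero n}} → ceilDiv (L + e * n) n ≡ ceilDiv L n + e
ceilDiv-+* L e (suc n) = begin
  (L + e * suc n + n) / suc n             ≡⟨ cong (_/ suc n) (swap L (e * suc n) n) ⟩
  (L + n + e * suc n) / suc n             ≡⟨ +-distrib-/-∣ʳ (L + n) (n∣m*n e) ⟩
  (L + n) / suc n + e * suc n / suc n     ≡⟨ cong (λ x → (L + n) / suc n + x) (m*n/n≡m e (suc n)) ⟩
  (L + n) / suc n + e                     ∎
  where
  open ≡-Reasoning
  swap : ∀ a b c → a + b + c ≡ a + c + b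
  swap = ℕ-Solver.solve-∀

last-of-residue : ∀ c M n .{{_ : NonZero n}} → c < M → Σ ℕ λ j → c + j * n < M × M ≤ c + n + j * n
last-of-residue c M n c<M = j , below , above
  where
  open ≤-Reasoning
  j = (M ∸ suc c) / n
  below : c + j * n < M
  below = begin-strict
    c + j * n              <⟨ s≤s (+-monoʳ-≤ c (m/n*n≤m (M ∸ suc c) n)) ⟩
    suc c + (M ∸ suc c)    ≡⟨ m+[n∸m]≡n c<M ⟩
    M                      ∎
  above : M ≤ c + n + j * n
  above = ≤-pred (begin-strict
    M                                        ≡⟨ m+[n∸m]≡n c<M ⟨
    suc c + (M ∸ suc c)                      ≡⟨ cong (λ x → suc c + x) (m≡m%n+[m/n]*n (M ∸ suc c) n) ⟩
    suc c + ((M ∸ suc c) % n + j * n)        <⟨ +-monoʳ-< (suc c) (+-monoˡ-< (j * n) (m%n<n (M ∸ suc c) n)) ⟩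
    suc c + (n + j * n)                      ≡⟨ cong suc (+-assoc c n (j * n)) ⟨
    suc (c + n + j * n)                      ∎)

offsets-combine : ∀ {p₀ τ₀ p τ t W K} →
  ∣ (+ p - + τ) - (+ p₀ - + τ₀) ∣ ≤ W → ∣ (+ p - + 0) - (+ τ - + t) ∣ ≤ K → ∣ + τ₀ - + t - + p₀ ∣ ≤ W + K
offsets-combine {p₀} {τ₀} {p} {τ} {t} {W} {K} ≤W ≤K = begin
  ∣ + τ₀ - + t - + p₀ ∣                     ≡⟨ cong ∣_∣ (regroup (+ p₀) (+ τ₀) (+ p) (+ τ) (+ t)) ⟩
  ∣ A - B ∣                                 ≤⟨ ℤ.∣i-j∣≤∣i∣+∣j∣ A B ⟩
  ∣ A ∣ + ∣ B ∣                             ≤⟨ +-mono-≤ ≤W ≤K ⟩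
  W + K                                     ∎
  where
  open ≤-Reasoning
  A = (+ p - + τ) - (+ p₀ - + τ₀)
  B = (+ p - + 0) - (+ τ - + t)
  regroup : ∀ (p₀ τ₀ p τ t : ℤ) → τ₀ - t - p₀ ≡ ((p - τ) - (p₀ - τ₀)) - ((p - + 0) - (τ - t))
  regroup = solve-∀

index-bound : ∀ c i j n e M → c + i * n + j * n < M + e * n → M ≤ c + n + j * n → i ≤ e
index-bound c i j n e M below above = ≤-pred (*-cancelʳ-< n i (suc e) (+-cancelˡ-< (c + j * n) _ _ (begin-strict
  c + j * n + i * n       ≡⟨ swap c (j * n) (i * n) ⟩
  c + i * n + j * n       <⟨ below ⟩
  M + e * n               ≤⟨ +-monoˡ-≤ (e * n) above ⟩
  c + n + j * n + e * n   ≡⟨ collect c n j e ⟩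
  c + j * n + suc e * n   ∎)))
  where
  open ≤-Reasoning
  swap : ∀ a b c → a + b + c ≡ a + c + b
  swap = ℕ-Solver.solve-∀
  collect : ∀ c n j e → c + n + j * n + e * n ≡ c + j * n + suc e * n
  collect = ℕ-Solver.solve-∀

m*n≤o⇒m≤o/n : ∀ m n o .{{_ : NonZero n}} → m * n ≤ o → m ≤ o / n
m*n≤o⇒m≤o/n m n o m*n≤o = subst (_≤ o / n) (m*n/n≡m m n) (/-monoˡ-≤ n m*n≤o)

-- Connectivity in edge lists

module _ {E : List Edge} where

  Adj-sym : ∀ {u v} → Adj E u v → Adj E v u
  Adj-sym (b , inj₁ e) = b , inj₂ e
  Adj-sym (b , inj₂ e) = b , inj₁ e

  Conn-sym : ∀ {u v} → Conn E u v → Conn E v u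
  Conn-sym = Star.reverse Adj-sym

  edge⇒Conn : ∀ {u v b} → edge u v b ∈ E → Conn E u v
  edge⇒Conn {b = b} e = (b , inj₁ e) ◅ ε

  InBlack-Conn : ∀ {u v} → InBlack E u → Conn E u v → v ≢ bot → InBlack E v
  InBlack-Conn (_ , noRed) u~v v≢bot = v≢bot , λ w w' e v~w → noRed w w' e (u~v ◅◅ v~w)

  InBlack⇒¬Conn-red : ∀ {u w w'} → InBlack E u → edge w w' false ∈ E → ¬ Conn E u w
  InBlack⇒¬Conn-red (_ , noRed) = noRed _ _

module _ {E E' : List Edge} (E⊆E' : E ⊆ E') where

  Conn-mono : ∀ {u v} → Conn E u v → Conn E' u v
  Conn-mono = Star.map λ where
    (b , inj₁ e) → b , inj₁ (E⊆E' e)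
    (b , inj₂ e) → b , inj₂ (E⊆E' e)

  InBlack-antitone : ∀ {v} → InBlack E' v → InBlack E v
  InBlack-antitone (v≢bot , noRed) = v≢bot , λ u u' e v~u → noRed u u' (E⊆E' e) (Conn-mono v~u)

-- Ranks in strictly increasing lists

rank : List ℕ → ℕ → ℕ
rank []       x = 0
rank (a ∷ as) x with a <? x
... | yes _ = suc (rank as x)
... | no  _ = rank as x

nth-∈ : ∀ xs {j} → j < length xs → nth xs j ∈ xs
nth-∈ (x ∷ xs) {zero}  _         = here refl
nth-∈ (x ∷ xs) {suc j} (s≤s j<n) = there (nth-∈ xs j<n)

nth-strictMono : ∀ {xs i j} → AllPairs _<_ xs → i < j → j < length xs → nth xs i < nth xs j
nth-strictMono {x ∷ xs} {zero}  {suc j} (x< ∷ _)  _         (s≤s j<n) = All.lookup x< (nth-∈ xs j<n)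
nth-strictMono {x ∷ xs} {suc i} {suc j} (_ ∷ sorted) (s≤s i<j) (s≤s j<n) = nth-strictMono sorted i<j j<n

rank-≤ : ∀ {x} xs → All (x ≤_) xs → rank xs x ≡ 0
rank-≤     []       _          = refl
rank-≤ {x} (a ∷ as) (x≤a ∷ x≤as) with a <? x
... | yes a<x = ⊥-elim (<⇒≱ a<x x≤a)
... | no  _   = rank-≤ as x≤as

rank-zero : ∀ xs → rank xs 0 ≡ 0
rank-zero xs = rank-≤ xs (All.tabulate λ _ → z≤n)

rank-< : ∀ {L} xs → All (_< L) xs → rank xs L ≡ length xs
rank-<     []       _          = refl
rank-< {L} (a ∷ as) (a<L ∷ as<L) with a <? L
... | yes _   = cong suc (rank-< as as<L)
... | no  a≮L = ⊥-elim (a≮L a<L)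

rank-≤-length : ∀ xs x → rank xs x ≤ length xs
rank-≤-length []       x = z≤n
rank-≤-length (a ∷ as) x with a <? x
... | yes _ = s≤s (rank-≤-length as x)
... | no  _ = m≤n⇒m≤1+n (rank-≤-length as x)

rank-mono-≤ : ∀ xs {x y} → x ≤ y → rank xs x ≤ rank xs y
rank-mono-≤ []       _   = z≤n
rank-mono-≤ (a ∷ as) {x} {y} x≤y with a <? x | a <? y
... | yes _   | yes _   = s≤s (rank-mono-≤ as x≤y)
... | yes a<x | no  a≮y = ⊥-elim (a≮y (<-≤-trans a<x x≤y))
... | no  _   | yes _   = m≤n⇒m≤1+n (rank-mono-≤ as x≤y)
... | no  _   | no  _   = rank-mono-≤ as x≤y

rank-nth : ∀ {xs} j → AllPairs _<_ xs → j < length xs → rank xs (nth xs j) ≡ j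
rank-nth {a ∷ as} zero (a< ∷ _) _ with a <? a
... | yes a<a = ⊥-elim (<-irrefl refl a<a)
... | no  _   = rank-≤ as (All.map <⇒≤ a<)
rank-nth {a ∷ as} (suc j) (a< ∷ sorted) (s≤s j<n) with a <? nth as j
... | yes _   = cong suc (rank-nth j sorted j<n)
... | no  a≮x = ⊥-elim (a≮x (All.lookup a< (nth-∈ as j<n)))

nth-rank : ∀ {xs x} → AllPairs _<_ xs → x ∈ xs → nth xs (rank xs x) ≡ x
nth-rank {a ∷ as} {x} (a< ∷ sorted) x∈ with a <? x
nth-rank (a< ∷ sorted) (here refl) | yes a<a = ⊥-elim (<-irrefl refl a<a)
nth-rank (a< ∷ sorted) (there x∈) | yes _   = nth-rank sorted x∈
nth-rank {a ∷ as} (a< ∷ sorted) (here refl) | no _ = cong (nth (a ∷ as)) (rank-≤ as (All.map <⇒≤ a<))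
nth-rank (a< ∷ sorted) (there x∈) | no a≮x = ⊥-elim (a≮x (All.lookup a< x∈))

rank-suc-∈ : ∀ {xs x} → AllPairs _<_ xs → x ∈ xs → rank xs (suc x) ≡ suc (rank xs x)
rank-suc-∈ {a ∷ as} {x} (a< ∷ sorted) x∈ with a <? suc x | a <? x
rank-suc-∈ (a< ∷ sorted) (here refl) | _ | yes a<a = ⊥-elim (<-irrefl refl a<a)
rank-suc-∈ {a ∷ as} (a< ∷ sorted) (here refl) | yes _ | no _ =
  cong suc (trans (rank-≤ as a<) (sym (rank-≤ as (All.map <⇒≤ a<))))
rank-suc-∈ (a< ∷ sorted) (there x∈) | yes _ | yes _   = cong suc (rank-suc-∈ sorted x∈)
rank-suc-∈ (a< ∷ sorted) (there x∈) | yes _ | no a≮x = ⊥-elim (a≮x (All.lookup a< x∈))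
rank-suc-∈ (a< ∷ sorted) (here refl) | no a≮1+a | _ = ⊥-elim (a≮1+a ≤-refl)
rank-suc-∈ (a< ∷ sorted) (there x∈) | no a≮1+x | _ = ⊥-elim (a≮1+x (<⇒≤ (s≤s (All.lookup a< x∈))))

rank-suc-∉ : ∀ {xs x} → x ∉ xs → rank xs (suc x) ≡ rank xs x
rank-suc-∉ {[]}     _ = refl
rank-suc-∉ {a ∷ as} {x} x∉ with a <? suc x | a <? x
... | yes _     | yes _   = cong suc (rank-suc-∉ (x∉ ∘′ there))
... | yes a<1+x | no  a≮x = ⊥-elim (x∉ (here (≤-antisym (≮⇒≥ a≮x) (≤-pred a<1+x))))
... | no  a≮1+x | yes a<x = ⊥-elim (a≮1+x (m≤n⇒m≤1+n a<x))
... | no  _     | no  _   = rank-suc-∉ (x∉ ∘′ there)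

rank-<-length : ∀ {xs x} → AllPairs _<_ xs → x ∈ xs → rank xs x < length xs
rank-<-length {xs} sorted x∈ = subst (_≤ length xs) (rank-suc-∈ sorted x∈) (rank-≤-length xs _)

rank-strictMono : ∀ {xs x y} → AllPairs _<_ xs → x ∈ xs → x < y → rank xs x < rank xs y
rank-strictMono {xs} sorted x∈ x<y = subst (_≤ rank xs _) (rank-suc-∈ sorted x∈) (rank-mono-≤ xs x<y)

-- Counting components by residue classes

AllPairs-lookup : ∀ {V : Set} {R : V → V → Set} → (∀ {x y} → R x y → R y x) →
  ∀ {xs} → AllPairs R xs → ∀ {i j} → i ≢ j → R (lookup xs i) (lookup xs j)
AllPairs-lookup R-sym (_ ∷ _)   {zero}  {zero}  i≢j = ⊥-elim (i≢j refl)
AllPairs-lookup R-sym (x~ ∷ _)  {zero}  {suc j} _   = All.lookup x~ (∈-lookup j)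
AllPairs-lookup R-sym (x~ ∷ _)  {suc i} {zero}  _   = R-sym (All.lookup x~ (∈-lookup i))
AllPairs-lookup R-sym (_ ∷ pws) {suc i} {suc j} i≢j = AllPairs-lookup R-sym pws (i≢j ∘ cong suc)

¬¬-∀-Fin : ∀ n {B : Fin n → Set} → (∀ i → ¬ ¬ B i) → ¬ ¬ (∀ i → B i)
¬¬-∀-Fin zero    _     ¬all = ¬all λ ()
¬¬-∀-Fin (suc n) {B} ¬¬B ¬all = ¬¬B zero λ B₀ → ¬¬-∀-Fin n (¬¬B ∘ suc) λ Bₛ → ¬all λ where
    zero    → B₀
    (suc i) → Bₛ i

module ClassCounting {V : Set} (R : V → V → Set)
  (R-sym : ∀ {u v} → R u v → R v u) (R-trans : ∀ {u v w} → R u v → R v w → R u w)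
  (Black : V → Set) (class : V → ℕ) (q : ℕ) {{_ : NonZero q}}
  (≡-mod⇒R : ∀ {u v} → Black u → Black v → class u % q ≡ class v % q → R u v) where

  private
    classFin : V → Fin q
    classFin v = Fin.fromℕ< (m%n<n (class v) q)

    classFin-≡ : ∀ {u v} → classFin u ≡ classFin v → class u % q ≡ class v % q
    classFin-≡ {u} {v} eq = trans (sym (Fin.toℕ-fromℕ< _)) (trans (cong toℕ eq) (Fin.toℕ-fromℕ< _))

    pairwise-unrelated : ∀ {reps} → AllPairs (λ u v → ¬ R u v) reps →
      ∀ {i j} → R (lookup reps i) (lookup reps j) → i ≡ j
    pairwise-unrelated unrelated {i} {j} related with i Fin.≟ j
    ... | yes i≡j = i≡j
    ... | no  i≢j = ⊥-elim (AllPairs-lookup (λ ¬uv vu → ¬uv (R-sym vu)) unrelated i≢j related)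

  representatives-length :
    (R⇒≡-mod : ∀ {u v} → Black u → R u v → class u % q ≡ class v % q) →
    (inhabited : ∀ r → r < q → Σ V λ v → Black v × class v ≡ r) →
    (reps : List V) → (∀ {r} → r ∈ reps → Black r) → AllPairs (λ u v → ¬ R u v) reps →
    (∀ {v} → Black v → Σ V λ r → r ∈ reps × R v r) →
    length reps ≡ q
  representatives-length R⇒≡-mod inhabited reps reps-black unrelated covers = ≤-antisym
    (Fin.injective⇒≤ {f = classFin ∘ lookup reps} λ eq →
      pairwise-unrelated unrelated (≡-mod⇒R (reps-black (∈-lookup _)) (reps-black (∈-lookup _)) (classFin-≡ eq)))
    (Fin.injective⇒≤ {f = repOf} λ {r₁} {r₂} eq → Fin.toℕ-injective (same-class eq))
    where
    witness : Fin q → V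
    witness r = proj₁ (inhabited (toℕ r) (Fin.toℕ<n r))
    witness-black : ∀ r → Black (witness r)
    witness-black r = proj₁ (proj₂ (inhabited (toℕ r) (Fin.toℕ<n r)))
    witness-class : ∀ r → class (witness r) ≡ toℕ r
    witness-class r = proj₂ (proj₂ (inhabited (toℕ r) (Fin.toℕ<n r)))
    cover : ∀ r → Σ V λ rep → rep ∈ reps × R (witness r) rep
    cover r = covers (witness-black r)
    repOf : Fin q → Fin (length reps)
    repOf r = index (proj₁ (proj₂ (cover r)))
    R-repOf : ∀ r → R (witness r) (lookup reps (repOf r))
    R-repOf r = subst (R (witness r)) (lookup-index (proj₁ (proj₂ (cover r)))) (proj₂ (proj₂ (cover r)))
    same-class : ∀ {r₁ r₂} → repOf r₁ ≡ repOf r₂ → toℕ r₁ ≡ toℕ r₂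
    same-class {r₁} {r₂} eq = begin
      toℕ r₁                  ≡⟨ m<n⇒m%n≡m (Fin.toℕ<n r₁) ⟨
      toℕ r₁ % q              ≡⟨ cong (_% q) (witness-class r₁) ⟨
      class (witness r₁) % q  ≡⟨ R⇒≡-mod (witness-black r₁) (R-trans (R-repOf r₁) shared-rep~r₂) ⟩
      class (witness r₂) % q  ≡⟨ cong (_% q) (witness-class r₂) ⟩
      toℕ r₂ % q              ≡⟨ m<n⇒m%n≡m (Fin.toℕ<n r₂) ⟩
      toℕ r₂                  ∎
      where
      open ≡-Reasoning
      shared-rep~r₂ : R (lookup reps (repOf r₁)) (witness r₂)
      shared-rep~r₂ = subst (λ i → R (lookup reps i) (witness r₂)) (sym eq) (R-sym (R-repOf r₂))

  record SplitsClasses (r : V) : Set where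
    field
      {u v}          : V
      u-black        : Black u
      v-black        : Black v
      r~u            : R r u
      r~v            : R r v
      classes-differ : class u % q ≢ class v % q

  private
    module Split {reps : List V} (unrelated : AllPairs (λ u v → ¬ R u v) reps)
      (split : ∀ i → SplitsClasses (lookup reps i)) where
      open SplitsClasses

      L = length reps

      owner : Fin L ⊎ Fin L → Fin L
      owner (inj₁ i) = i
      owner (inj₂ i) = i

      picked : Fin L ⊎ Fin L → V
      picked (inj₁ i) = u (split i)
      picked (inj₂ i) = v (split i)

      picked-black : ∀ s → Black (picked s)
      picked-black (inj₁ i) = u-black (split i)
      picked-black (inj₂ i) = v-black (split i)

      owner~picked : ∀ s → R (lookup reps (owner s)) (picked s)
      owner~picked (inj₁ i) = r~u (split i)
      owner~picked (inj₂ i) = r~v (split i)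

      same-owner : ∀ s₁ s₂ → class (picked s₁) % q ≡ class (picked s₂) % q → owner s₁ ≡ owner s₂
      same-owner s₁ s₂ eq = pairwise-unrelated unrelated
        (R-trans (owner~picked s₁) (R-trans (≡-mod⇒R (picked-black s₁) (picked-black s₂) eq) (R-sym (owner~picked s₂))))

      pick : Fin L ⊎ Fin L → Fin q
      pick = classFin ∘ picked

      pick-injective : ∀ {s₁ s₂} → pick s₁ ≡ pick s₂ → s₁ ≡ s₂
      pick-injective {inj₁ i} {inj₁ j} eq = cong inj₁ (same-owner (inj₁ i) (inj₁ j) (classFin-≡ eq))
      pick-injective {inj₂ i} {inj₂ j} eq = cong inj₂ (same-owner (inj₂ i) (inj₂ j) (classFin-≡ eq))
      pick-injective {inj₁ i} {inj₂ j} eq with same-owner (inj₁ i) (inj₂ j) (classFin-≡ eq)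
      ... | refl = ⊥-elim (classes-differ (split i) (classFin-≡ eq))
      pick-injective {inj₂ i} {inj₁ j} eq with same-owner (inj₂ i) (inj₁ j) (classFin-≡ eq)
      ... | refl = ⊥-elim (classes-differ (split i) (sym (classFin-≡ eq)))

      2L≤q : 2 * L ≤ q
      2L≤q = subst (_≤ q) (cong (λ x → L + x) (sym (+-identityʳ L))) (Fin.injective⇒≤ {f = pick ∘ splitAt L} λ {x} {y} eq →
        trans (sym (Fin.join-splitAt L L x))
              (trans (cong (join L L) (pick-injective {splitAt L x} {splitAt L y} eq)) (Fin.join-splitAt L L y)))

  -- Connectivity is not decidable here, so splitting is only known under double negation;
  -- the decidable conclusion absorbs it.
  splitting-representatives-length : (reps : List V) → AllPairs (λ u v → ¬ R u v) reps →
    (∀ {r} → r ∈ reps → ¬ ¬ SplitsClasses r) → 2 * length reps ≤ q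
  splitting-representatives-length reps unrelated splits =
    decidable-stable (2 * length reps ≤? q) λ 2L≰q →
      ¬¬-∀-Fin (length reps) (λ i → splits (∈-lookup i)) λ split → 2L≰q (Split.2L≤q unrelated split)

-- Alignments, their edges and the ranks of black characters

module AlignmentEdges {A : Set} (eq : DecidableEquality A) (P T : List A) where

  private
    edges : ℕ → ℕ → List Step → List Edge
    edges = edgesFrom eq P T
    costs : ℕ → ℕ → List Step → ℕ
    costs = costFrom eq P T

  edgesFrom-covers : ∀ ss x y z → x ≤ z → z < x + dX ss →
    (Σ ℕ λ y' → Σ Bool λ bl → edge (pv z) (tv y') bl ∈ edges x y ss × y' < y + dY ss)
    ⊎ edge (pv z) bot false ∈ edges x y ss
  edgesFrom-covers [] x y z x≤z z<x+0 = ⊥-elim (<⇒≱ (subst (z <_) (+-identityʳ x) z<x+0) x≤z)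
  edgesFrom-covers (diag ∷ ss) x y z x≤z z< with x ≟ z
  ... | yes refl = inj₁ (y , _ , here refl , subst (y <_) (sym (+-suc y (dY ss))) (s≤s (m≤m+n y _)))
  ... | no x≢z with edgesFrom-covers ss (suc x) (suc y) z (≤∧≢⇒< x≤z x≢z) (subst (z <_) (+-suc x (dX ss)) z<)
  ...   | inj₁ (y' , bl , e , y'<) = inj₁ (y' , bl , there e , subst (y' <_) (sym (+-suc y (dY ss))) y'<)
  ...   | inj₂ e = inj₂ (there e)
  edgesFrom-covers (del ∷ ss) x y z x≤z z< with x ≟ z
  ... | yes refl = inj₂ (here refl)
  ... | no x≢z with edgesFrom-covers ss (suc x) y z (≤∧≢⇒< x≤z x≢z) (subst (z <_) (+-suc x (dX ss)) z<)
  ...   | inj₁ (y' , bl , e , y'<) = inj₁ (y' , bl , there e , y'<)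
  ...   | inj₂ e = inj₂ (there e)
  edgesFrom-covers (ins ∷ ss) x y z x≤z z< with edgesFrom-covers ss x (suc y) z x≤z z<
  ... | inj₁ (y' , bl , e , y'<) = inj₁ (y' , bl , there e , subst (y' <_) (sym (+-suc y (dY ss))) y'<)
  ... | inj₂ e = inj₂ (there e)

  data EdgeShape : Edge → Set where
    diagonal : ∀ z y' bl → EdgeShape (edge (pv z) (tv y') bl)
    deletion : ∀ z → EdgeShape (edge (pv z) bot false)
    insertion : ∀ y' → EdgeShape (edge bot (tv y') false)

  edgesFrom-shape : ∀ ss x y {e} → e ∈ edges x y ss → EdgeShape e
  edgesFrom-shape (diag ∷ ss) x y (here refl) = diagonal _ _ _
  edgesFrom-shape (del ∷ ss)  x y (here refl) = deletion _
  edgesFrom-shape (ins ∷ ss)  x y (here refl) = insertion _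
  edgesFrom-shape (diag ∷ ss) x y (there e) = edgesFrom-shape ss _ _ e
  edgesFrom-shape (del ∷ ss)  x y (there e) = edgesFrom-shape ss _ _ e
  edgesFrom-shape (ins ∷ ss)  x y (there e) = edgesFrom-shape ss _ _ e

  edgesFrom-lower : ∀ ss x y {z y' bl} → edge (pv z) (tv y') bl ∈ edges x y ss → x ≤ z × y ≤ y'
  edgesFrom-lower (diag ∷ ss) x y (here refl) = ≤-refl , ≤-refl
  edgesFrom-lower (diag ∷ ss) x y (there e) with edgesFrom-lower ss _ _ e
  ... | x< , y< = <⇒≤ x< , <⇒≤ y<
  edgesFrom-lower (del ∷ ss) x y (there e) with edgesFrom-lower ss _ _ e
  ... | x< , y≤ = <⇒≤ x< , y≤
  edgesFrom-lower (ins ∷ ss) x y (there e) with edgesFrom-lower ss _ _ e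
  ... | x≤ , y< = x≤ , <⇒≤ y<

  edgesFrom-strictMono : ∀ ss x y {z₁ y₁ b₁ z₂ y₂ b₂} →
    edge (pv z₁) (tv y₁) b₁ ∈ edges x y ss → edge (pv z₂) (tv y₂) b₂ ∈ edges x y ss → z₁ < z₂ → y₁ < y₂
  edgesFrom-strictMono (diag ∷ ss) x y (here refl) (here refl) z<z = ⊥-elim (<-irrefl refl z<z)
  edgesFrom-strictMono (diag ∷ ss) x y (here refl) (there e₂) _ = proj₂ (edgesFrom-lower ss _ _ e₂)
  edgesFrom-strictMono (diag ∷ ss) x y (there e₁) (here refl) z₁<x =
    ⊥-elim (<⇒≱ z₁<x (<⇒≤ (proj₁ (edgesFrom-lower ss _ _ e₁))))
  edgesFrom-strictMono (diag ∷ ss) x y (there e₁) (there e₂) = edgesFrom-strictMono ss _ _ e₁ e₂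
  edgesFrom-strictMono (del ∷ ss)  x y (there e₁) (there e₂) = edgesFrom-strictMono ss _ _ e₁ e₂
  edgesFrom-strictMono (ins ∷ ss)  x y (there e₁) (there e₂) = edgesFrom-strictMono ss _ _ e₁ e₂

  edgesFrom-functional : ∀ ss x y {z y₁ b₁ y₂ b₂} →
    edge (pv z) (tv y₁) b₁ ∈ edges x y ss → edge (pv z) (tv y₂) b₂ ∈ edges x y ss → y₁ ≡ y₂
  edgesFrom-functional (diag ∷ ss) x y (here refl) (here refl) = refl
  edgesFrom-functional (diag ∷ ss) x y (here refl) (there e₂) = ⊥-elim (<-irrefl refl (proj₁ (edgesFrom-lower ss _ _ e₂)))
  edgesFrom-functional (diag ∷ ss) x y (there e₁) (here refl) = ⊥-elim (<-irrefl refl (proj₁ (edgesFrom-lower ss _ _ e₁)))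
  edgesFrom-functional (diag ∷ ss) x y (there e₁) (there e₂) = edgesFrom-functional ss _ _ e₁ e₂
  edgesFrom-functional (del ∷ ss)  x y (there e₁) (there e₂) = edgesFrom-functional ss _ _ e₁ e₂
  edgesFrom-functional (ins ∷ ss)  x y (there e₁) (there e₂) = edgesFrom-functional ss _ _ e₁ e₂

  dX≤costFrom+dY : ∀ ss x y → dX ss ≤ costs x y ss + dY ss
  dX≤costFrom+dY [] x y = z≤n
  dX≤costFrom+dY (diag ∷ ss) x y with matchB eq (at P x) (at T y)
  ... | true  = subst (suc (dX ss) ≤_) (sym (+-suc _ _)) (s≤s (dX≤costFrom+dY ss (suc x) (suc y)))
  ... | false = m≤n⇒m≤1+n (subst (suc (dX ss) ≤_) (sym (+-suc _ _)) (s≤s (dX≤costFrom+dY ss (suc x) (suc y))))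
  dX≤costFrom+dY (del ∷ ss) x y = s≤s (dX≤costFrom+dY ss (suc x) y)
  dX≤costFrom+dY (ins ∷ ss) x y = ≤-trans (dX≤costFrom+dY ss x (suc y)) (+-mono-≤ (n≤1+n _) (n≤1+n _))

  dY≤costFrom+dX : ∀ ss x y → dY ss ≤ costs x y ss + dX ss
  dY≤costFrom+dX [] x y = z≤n
  dY≤costFrom+dX (diag ∷ ss) x y with matchB eq (at P x) (at T y)
  ... | true  = subst (suc (dY ss) ≤_) (sym (+-suc _ _)) (s≤s (dY≤costFrom+dX ss (suc x) (suc y)))
  ... | false = m≤n⇒m≤1+n (subst (suc (dY ss) ≤_) (sym (+-suc _ _)) (s≤s (dY≤costFrom+dX ss (suc x) (suc y))))
  dY≤costFrom+dX (del ∷ ss) x y = ≤-trans (dY≤costFrom+dX ss (suc x) y) (+-mono-≤ (n≤1+n _) (n≤1+n _))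
  dY≤costFrom+dX (ins ∷ ss) x y = s≤s (dY≤costFrom+dX ss x (suc y))

  costFrom-diag-mono : ∀ x y {ss₁ ss} → costs (suc x) (suc y) ss₁ ≤ costs (suc x) (suc y) ss →
    costs x y (diag ∷ ss₁) ≤ costs x y (diag ∷ ss)
  costFrom-diag-mono x y c≤ with matchB eq (at P x) (at T y)
  ... | true  = c≤
  ... | false = s≤s c≤

  edgesFrom-prefix : ∀ ss x y {z y' bl} → edge (pv z) (tv y') bl ∈ edges x y ss →
    EDle eq P x z T y y' (costs x y ss)
  edgesFrom-prefix (diag ∷ ss) x y (here refl) =
    mkAl x y [] , ((refl , +-identityʳ x) , (refl , +-identityʳ y)) , z≤n
  edgesFrom-prefix (diag ∷ ss) x y (there e) with edgesFrom-prefix ss (suc x) (suc y) e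
  ... | mkAl _ _ ss₁ , ((refl , refl) , (refl , refl)) , c≤ =
    mkAl x y (diag ∷ ss₁) , ((refl , +-suc x (dX ss₁)) , (refl , +-suc y (dY ss₁))) , costFrom-diag-mono x y c≤
  edgesFrom-prefix (del ∷ ss) x y (there e) with edgesFrom-prefix ss (suc x) y e
  ... | mkAl _ _ ss₁ , ((refl , refl) , (refl , refl)) , c≤ =
    mkAl x y (del ∷ ss₁) , ((refl , +-suc x (dX ss₁)) , (refl , refl)) , s≤s c≤
  edgesFrom-prefix (ins ∷ ss) x y (there e) with edgesFrom-prefix ss x (suc y) e
  ... | mkAl _ _ ss₁ , ((refl , refl) , (refl , refl)) , c≤ =
    mkAl x y (ins ∷ ss₁) , ((refl , refl) , (refl , +-suc y (dY ss₁))) , s≤s c≤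

EDle⇒∣offset-offset∣≤ : ∀ {A : Set} (eq : DecidableEquality A) {X x x' Y y y' d} →
  EDle eq X x x' Y y y' d → ∣ (+ x' - + x) - (+ y' - + y) ∣ ≤ d
EDle⇒∣offset-offset∣≤ eq {X} {Y = Y} (mkAl x y ss , ((refl , refl) , (refl , refl)) , c≤d)
  rewrite offset-difference x (dX ss) y (dY ss) =
  ∣+m-+n∣≤ (≤-trans (dX≤costFrom+dY ss x y) (+-monoˡ-≤ _ c≤d))
           (≤-trans (dY≤costFrom+dX ss x y) (+-monoˡ-≤ _ c≤d))
  where open AlignmentEdges eq X Y

module _ {A : Set} (eq : DecidableEquality A) (P T : List A) where

  alignmentEdges⊆graphEdges : ∀ {S X} → X ∈ S → alignmentEdges eq P T X ⊆ graphEdges eq P T S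
  alignmentEdges⊆graphEdges X∈S e∈ = ∈-concatMap⁺ (alignmentEdges eq P T) (Any.map (λ { refl → e∈ }) X∈S)

  graphEdges-origin : ∀ S {e} → e ∈ graphEdges eq P T S → Σ Alignment λ X → X ∈ S × e ∈ alignmentEdges eq P T X
  graphEdges-origin S e∈ = find (∈-concatMap⁻ (alignmentEdges eq P T) {xs = S} e∈)

module BlackPositions {A : Set} (eq : DecidableEquality A) (P T : List A) (E : List Edge) (ps ts : List ℕ)
  (blackP : BlackPositionsP P T E ps) (blackT : BlackPositionsT P T E ts) where

  open AlignmentEdges eq P T

  M N : ℕ
  M = length ps
  N = length ts

  Pv Tv : ℕ → Vertex
  Pv j = pv (nth ps j)
  Tv i = tv (nth ts i)

  ps-sorted : AllPairs _<_ ps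
  ps-sorted = proj₁ blackP
  ts-sorted : AllPairs _<_ ts
  ts-sorted = proj₁ blackT

  ∈ps⇒black : ∀ {x} → x ∈ ps → x < length P × InBlack E (pv x)
  ∈ps⇒black {x} = proj₁ (proj₂ blackP x)
  black⇒∈ps : ∀ {x} → x < length P → InBlack E (pv x) → x ∈ ps
  black⇒∈ps {x} x<|P| bl = proj₂ (proj₂ blackP x) (x<|P| , bl)
  ∈ts⇒black : ∀ {y} → y ∈ ts → y < length T × InBlack E (tv y)
  ∈ts⇒black {y} = proj₁ (proj₂ blackT y)
  black⇒∈ts : ∀ {y} → y < length T → InBlack E (tv y) → y ∈ ts
  black⇒∈ts {y} y<|T| bl = proj₂ (proj₂ blackT y) (y<|T| , bl)

  matched-from-black : ∀ {z y' bl} → edge (pv z) (tv y') bl ∈ E → z ∈ ps → y' < length T → bl ≡ true × y' ∈ ts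
  matched-from-black {bl = false} e z∈ _ = ⊥-elim (InBlack⇒¬Conn-red (proj₂ (∈ps⇒black z∈)) e ε)
  matched-from-black {bl = true}  e z∈ y'<|T| =
    refl , black⇒∈ts y'<|T| (InBlack-Conn (proj₂ (∈ps⇒black z∈)) (edge⇒Conn e) λ ())

  aligned-to-black : ∀ {z y' bl} → edge (pv z) (tv y') bl ∈ E → y' ∈ ts → z < length P → z ∈ ps
  aligned-to-black e y'∈ z<|P| = black⇒∈ps z<|P| (InBlack-Conn (proj₂ (∈ts⇒black y'∈)) (Conn-sym (edge⇒Conn e)) λ ())

  deleted∉ps : ∀ {z} → edge (pv z) bot false ∈ E → z ∉ ps
  deleted∉ps e z∈ = InBlack⇒¬Conn-red (proj₂ (∈ps⇒black z∈)) e ε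

  inserted∉ts : ∀ {y'} → edge bot (tv y') false ∈ E → y' ∉ ts
  inserted∉ts e y'∈ = InBlack⇒¬Conn-red (proj₂ (∈ts⇒black y'∈)) e (Conn-sym (edge⇒Conn e))

  -- An aligned pair is black on both sides or on neither, so ranks advance together.
  rank-offset-step : ∀ {x y bl s} → edge (pv x) (tv y) bl ∈ E → x < length P → y < length T →
    rank ps x + s ≡ rank ts y → rank ps (suc x) + s ≡ rank ts (suc y)
  rank-offset-step {x} {y} {s = s} e x<|P| y<|T| inv with x ∈? ps
  ... | yes x∈ = begin
    rank ps (suc x) + s   ≡⟨ cong (_+ s) (rank-suc-∈ ps-sorted x∈) ⟩
    suc (rank ps x + s)   ≡⟨ cong suc inv ⟩
    suc (rank ts y)       ≡⟨ rank-suc-∈ ts-sorted (proj₂ (matched-from-black e x∈ y<|T|)) ⟨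
    rank ts (suc y)       ∎
    where open ≡-Reasoning
  ... | no x∉ = begin
    rank ps (suc x) + s   ≡⟨ cong (_+ s) (rank-suc-∉ x∉) ⟩
    rank ps x + s         ≡⟨ inv ⟩
    rank ts y             ≡⟨ rank-suc-∉ (λ y∈ → x∉ (aligned-to-black e y∈ x<|P|)) ⟨
    rank ts (suc y)       ∎
    where open ≡-Reasoning

  rank-offset-invariant : ∀ ss x y s → edgesFrom eq P T x y ss ⊆ E →
    x + dX ss ≤ length P → y + dY ss ≤ length T → rank ps x + s ≡ rank ts y →
    (∀ {z y' bl} → edge (pv z) (tv y') bl ∈ edgesFrom eq P T x y ss → rank ps z + s ≡ rank ts y')
    × rank ps (x + dX ss) + s ≡ rank ts (y + dY ss)
  rank-offset-invariant [] x y s _ _ _ inv =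
    (λ ()) , subst₂ (λ x' y' → rank ps x' + s ≡ rank ts y') (sym (+-identityʳ x)) (sym (+-identityʳ y)) inv
  rank-offset-invariant (diag ∷ ss) x y s ⊆E x+≤ y+≤ inv =
    (λ { (here refl) → inv ; (there e) → proj₁ rest e }) ,
    subst₂ (λ x' y' → rank ps x' + s ≡ rank ts y') (sym (+-suc x (dX ss))) (sym (+-suc y (dY ss))) (proj₂ rest)
    where
    x+≤' = subst (_≤ length P) (+-suc x (dX ss)) x+≤
    y+≤' = subst (_≤ length T) (+-suc y (dY ss)) y+≤
    rest = rank-offset-invariant ss (suc x) (suc y) s (⊆E ∘′ there) x+≤' y+≤'
             (rank-offset-step (⊆E (here refl)) (≤-trans (s≤s (m≤m+n x _)) x+≤') (≤-trans (s≤s (m≤m+n y _)) y+≤') inv)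
  rank-offset-invariant (del ∷ ss) x y s ⊆E x+≤ y+≤ inv =
    (λ { (there e) → proj₁ rest e }) ,
    subst (λ x' → rank ps x' + s ≡ rank ts (y + dY ss)) (sym (+-suc x (dX ss))) (proj₂ rest)
    where
    rest = rank-offset-invariant ss (suc x) y s (⊆E ∘′ there) (subst (_≤ length P) (+-suc x (dX ss)) x+≤) y+≤
             (trans (cong (_+ s) (rank-suc-∉ (deleted∉ps (⊆E (here refl))))) inv)
  rank-offset-invariant (ins ∷ ss) x y s ⊆E x+≤ y+≤ inv =
    (λ { (there e) → proj₁ rest e }) ,
    subst (λ y' → rank ps (x + dX ss) + s ≡ rank ts y') (sym (+-suc y (dY ss))) (proj₂ rest)
    where
    rest = rank-offset-invariant ss x (suc y) s (⊆E ∘′ there) x+≤ (subst (_≤ length T) (+-suc y (dY ss)) y+≤)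
             (trans inv (sym (rank-suc-∉ (inserted∉ts (⊆E (here refl))))))

  rank-ps-|P| : rank ps (length P) ≡ M
  rank-ps-|P| = rank-< ps (All.tabulate (proj₁ ∘′ ∈ps⇒black))

  rank-ts-|T| : rank ts (length T) ≡ N
  rank-ts-|T| = rank-< ts (All.tabulate (proj₁ ∘′ ∈ts⇒black))

  shift : Alignment → ℕ
  shift X = rank ts (sy X)

  shift-invariant : ∀ {k u u' X} → AlignPT eq k P T u u' X → alignmentEdges eq P T X ⊆ E →
    (∀ {z y' bl} → edge (pv z) (tv y') bl ∈ alignmentEdges eq P T X → rank ps z + shift X ≡ rank ts y')
    × M + shift X ≡ rank ts u'
  shift-invariant {X = mkAl .0 y ss} (((refl , dX≡|P|) , (refl , refl)) , u'≤|T| , _) X⊆E =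
    proj₁ inv , (begin
      M + rank ts y              ≡⟨ cong (_+ rank ts y) rank-ps-|P| ⟨
      rank ps (length P) + rank ts y ≡⟨ cong (λ x → rank ps x + rank ts y) dX≡|P| ⟨
      rank ps (dX ss) + rank ts y ≡⟨ proj₂ inv ⟩
      rank ts (y + dY ss)        ∎)
    where
    open ≡-Reasoning
    inv = rank-offset-invariant ss 0 y (rank ts y) X⊆E (≤-reflexive dX≡|P|) u'≤|T| (cong (_+ rank ts y) (rank-zero ps))

  shift-linked : ∀ {k u u' X} → AlignPT eq k P T u u' X → alignmentEdges eq P T X ⊆ E →
    ∀ j → j < M → Conn E (Pv j) (Tv (j + shift X)) × j + shift X < N
  shift-linked {X = X@(mkAl .0 y ss)} X-aligns@(((refl , dX≡|P|) , (refl , refl)) , u'≤|T| , _) X⊆E j j<M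
    with edgesFrom-covers ss 0 y (nth ps j) z≤n (subst (nth ps j <_) (sym dX≡|P|) (proj₁ (∈ps⇒black (nth-∈ ps j<M))))
  ... | inj₂ e = ⊥-elim (deleted∉ps (X⊆E e) (nth-∈ ps j<M))
  ... | inj₁ (y' , _ , e , y'<) =
    subst (Conn E (Pv j) ∘′ tv) y'≡ (edge⇒Conn (X⊆E e)) ,
    subst (_< N) rank-y' (rank-<-length ts-sorted y'∈)
    where
    y'∈ : y' ∈ ts
    y'∈ = proj₂ (matched-from-black (X⊆E e) (nth-∈ ps j<M) (≤-trans y'< u'≤|T|))
    rank-y' : rank ts y' ≡ j + shift X
    rank-y' = trans (sym (proj₁ (shift-invariant X-aligns X⊆E) e)) (cong (_+ shift X) (rank-nth j ps-sorted j<M))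
    y'≡ : y' ≡ nth ts (j + shift X)
    y'≡ = trans (sym (nth-rank ts-sorted y'∈)) (cong (nth ts) rank-y')

-- The black components of G_S

module Components {A : Set} (eq : DecidableEquality A) (k : ℕ) (P T : List A) (S : List Alignment)
  (S-aligns : ∀ X → X ∈ S → Σ ℕ λ u → Σ ℕ λ u' → AlignPT eq k P T u u' X)
  (ps ts : List ℕ)
  (blackP : BlackPositionsP P T (graphEdges eq P T S) ps)
  (blackT : BlackPositionsT P T (graphEdges eq P T S) ts) where

  E : List Edge
  E = graphEdges eq P T S

  open BlackPositions eq P T E ps ts blackP blackT public
  open AlignmentEdges eq P T

  Black : Vertex → Set
  Black v = IsVertex P T v × InBlack E v

  rankOf : Vertex → ℕ
  rankOf (pv x) = rank ps x
  rankOf (tv y) = rank ts y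
  rankOf bot    = 0

  black-vertex : ∀ {u} → Black u → (u ≡ Pv (rankOf u) × rankOf u < M) ⊎ (u ≡ Tv (rankOf u) × rankOf u < N)
  black-vertex {pv x} (x<|P| , bl) = inj₁ (cong pv (sym (nth-rank ps-sorted x∈)) , rank-<-length ps-sorted x∈)
    where x∈ = black⇒∈ps x<|P| bl
  black-vertex {tv y} (y<|T| , bl) = inj₂ (cong tv (sym (nth-rank ts-sorted y∈)) , rank-<-length ts-sorted y∈)
    where y∈ = black⇒∈ts y<|T| bl
  black-vertex {bot} (_ , bl) = ⊥-elim (proj₁ bl refl)

  Pv-black : ∀ j → j < M → Black (Pv j)
  Pv-black j j<M = ∈ps⇒black (nth-∈ ps j<M)

  rankOf-Pv : ∀ j → j < M → rankOf (Pv j) ≡ j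
  rankOf-Pv j = rank-nth j ps-sorted

  linked : ∀ {X} → X ∈ S → ∀ j → j < M → Conn E (Pv j) (Tv (j + shift X)) × j + shift X < N
  linked {X} X∈S with S-aligns X X∈S
  ... | _ , _ , X-aligns = shift-linked X-aligns (alignmentEdges⊆graphEdges eq P T X∈S)

  rank-end : ∀ {X} → X ∈ S → rank ts (ey X) ≡ M + shift X
  rank-end {X} X∈S with S-aligns X X∈S
  ... | _ , _ , X-aligns@((_ , (_ , ey≡u')) , _) =
    trans (cong (rank ts) ey≡u') (sym (proj₂ (shift-invariant X-aligns (alignmentEdges⊆graphEdges eq P T X∈S))))

  shift-bound : ∀ {X} → X ∈ S → M + shift X ≤ N
  shift-bound {X} X∈S = subst (_≤ N) (rank-end X∈S) (rank-≤-length ts (ey X))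

  module _ (q : ℕ) .{{_ : NonZero q}} (q∣shifts : ∀ {X} → X ∈ S → q ∣ shift X) where

    private
      edge-≡-mod : ∀ {u₀ a b bl} → InBlack E u₀ → Conn E u₀ a → edge a b bl ∈ E → rankOf a % q ≡ rankOf b % q
      edge-≡-mod black u₀~a e with graphEdges-origin eq P T S e
      ... | X , X∈S , eX with edgesFrom-shape (steps X) (sx X) (sy X) eX | S-aligns X X∈S
      ... | diagonal z y' _ | _ , _ , X-aligns =
        trans (sym (%-remove-+ʳ (rank ps z) (q∣shifts X∈S)))
              (cong (_% q) (proj₁ (shift-invariant X-aligns (alignmentEdges⊆graphEdges eq P T X∈S)) eX))
      ... | deletion _  | _ = ⊥-elim (InBlack⇒¬Conn-red black e u₀~a)
      ... | insertion _ | _ = ⊥-elim (InBlack⇒¬Conn-red black e u₀~a)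

      path-≡-mod : ∀ {u₀ u v} → InBlack E u₀ → Conn E u₀ u → Conn E u v → rankOf u % q ≡ rankOf v % q
      path-≡-mod black u₀~u ε = refl
      path-≡-mod black u₀~u (step@(_ , inj₁ e) ◅ path) =
        trans (edge-≡-mod black u₀~u e) (path-≡-mod black (u₀~u ◅◅ (step ◅ ε)) path)
      path-≡-mod black u₀~u (step@(_ , inj₂ e) ◅ path) =
        trans (sym (edge-≡-mod black (u₀~u ◅◅ (step ◅ ε)) e)) (path-≡-mod black (u₀~u ◅◅ (step ◅ ε)) path)

    Conn⇒≡-mod : ∀ {u v} → InBlack E u → Conn E u v → rankOf u % q ≡ rankOf v % q
    Conn⇒≡-mod black = path-≡-mod black ε

  module Enclosed (encloses : length T + 2 * k ≤ 2 * length P)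
    (Xpref : Alignment) (Xpref∈S : Xpref ∈ S) (Xpref-start : sy Xpref ≡ 0)
    (Xsuf : Alignment) (Xsuf∈S : Xsuf ∈ S) (Xsuf-end : ey Xsuf ≡ length T) where

    d : ℕ
    d = shift Xsuf

    shift-Xpref : shift Xpref ≡ 0
    shift-Xpref = trans (cong (rank ts) Xpref-start) (rank-zero ts)

    M+d≡N : M + d ≡ N
    M+d≡N = trans (sym (rank-end Xsuf∈S)) (trans (cong (rank ts) Xsuf-end) rank-ts-|T|)

    M≤N : M ≤ N
    M≤N = subst (M ≤_) M+d≡N (m≤m+n M d)

    prefix-linked : ∀ j → j < M → Conn E (Pv j) (Tv j)
    prefix-linked j j<M = subst (λ i → Conn E (Pv j) (Tv i)) (trans (cong (λ x → j + x) shift-Xpref) (+-identityʳ j))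
                                (proj₁ (linked Xpref∈S j j<M))

    suffix-linked : ∀ j → j < M → Conn E (Pv j) (Tv (j + d))
    suffix-linked j j<M = proj₁ (linked Xsuf∈S j j<M)

    private
      |P|≤k+dY : ∀ {X} → X ∈ S → length P ≤ k + dY (steps X)
      |P|≤k+dY {X} X∈S with S-aligns X X∈S
      ... | _ , _ , ((sx≡0 , ex≡|P|) , _) , _ , cost≤k =
        subst (_≤ k + dY (steps X)) (trans (cong (_+ dX (steps X)) (sym sx≡0)) ex≡|P|)
              (≤-trans (dX≤costFrom+dY (steps X) (sx X) (sy X)) (+-monoˡ-≤ _ cost≤k))

      -- Both alignments are long, so with |T| ≤ 2|P| - 2k the suffix one starts before the
      -- prefix one ends.
      start≤end : ∀ {p t s ds dp} → p ≤ k + ds → p ≤ k + dp → s + ds ≡ t → t + 2 * k ≤ 2 * p → s ≤ dp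
      start≤end {p} {t} {s} {ds} {dp} p≤ds p≤dp s+ds≡t enc = +-cancelʳ-≤ (2 * p) s dp (begin
        s + 2 * p                       ≤⟨ +-monoʳ-≤ s (+-mono-≤ p≤ds (+-monoˡ-≤ 0 p≤dp)) ⟩
        s + (k + ds + (k + dp + 0))     ≡⟨ regroup s k ds dp ⟩
        (s + ds) + 2 * k + dp           ≡⟨ cong (λ t → t + 2 * k + dp) s+ds≡t ⟩
        t + 2 * k + dp                  ≤⟨ +-monoˡ-≤ dp enc ⟩
        2 * p + dp                      ≡⟨ +-comm (2 * p) dp ⟩
        dp + 2 * p                      ∎)
        where
        open ≤-Reasoning
        regroup : ∀ s k ds dp → s + (k + ds + (k + dp + 0)) ≡ (s + ds) + 2 * k + dp
        regroup = ℕ-Solver.solve-∀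

    d≤M : d ≤ M
    d≤M = begin
      rank ts (sy Xsuf)                    ≤⟨ rank-mono-≤ ts Xsuf-starts-early ⟩
      rank ts (dY (steps Xpref))           ≡⟨ cong (λ y → rank ts (y + dY (steps Xpref))) Xpref-start ⟨
      rank ts (ey Xpref)                   ≡⟨ rank-end Xpref∈S ⟩
      M + shift Xpref                      ≡⟨ cong (λ x → M + x) shift-Xpref ⟩
      M + 0                                ≡⟨ +-identityʳ M ⟩
      M                                    ∎
      where
      open ≤-Reasoning
      Xsuf-starts-early = start≤end (|P|≤k+dY Xsuf∈S) (|P|≤k+dY Xpref∈S) Xsuf-end encloses

    -- The black components of G_S are the residue classes of rankOf modulo q:
    -- q∣shifts yields one inclusion through Conn⇒≡-mod, ≡-mod⇒Conn the other.
    record ResidueClasses (q : ℕ) : Set where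
      field
        {{q≢0}} : NonZero q
        q∣shifts : ∀ {X} → X ∈ S → q ∣ shift X
        ≡-mod⇒Conn : ∀ {u v} → Black u → Black v → rankOf u % q ≡ rankOf v % q → Conn E u v
        q≤M : q ≤ M


    module Periodic {{_ : NonZero d}} where

      T-linked : ∀ a r → r < d → r + a * d < N → Conn E (Tv (r + a * d)) (Pv r)
      T-linked zero r r<d _ =
        subst (λ i → Conn E (Tv i) (Pv r)) (sym (+-identityʳ r)) (Conn-sym (prefix-linked r (≤-trans r<d d≤M)))
      T-linked (suc a) r r<d r+[1+a]d<N =
        subst (λ i → Conn E (Tv i) (Pv j)) j+d≡ (Conn-sym (suffix-linked j j<M)) ◅◅
        prefix-linked j j<M ◅◅ T-linked a r r<d (<-≤-trans j<M M≤N)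
        where
        j = r + a * d
        j+d≡ : j + d ≡ r + suc a * d
        j+d≡ = trans (+-assoc r (a * d) d) (cong (λ x → r + x) (+-comm (a * d) d))
        j<M : j < M
        j<M = +-cancelʳ-< d j M (subst₂ _<_ (sym j+d≡) (sym M+d≡N) r+[1+a]d<N)

      T-linked-mod : ∀ i → i < N → Conn E (Tv i) (Pv (i % d))
      T-linked-mod i i<N = subst (λ j → Conn E (Tv j) (Pv (i % d))) (sym (m≡m%n+[m/n]*n i d))
        (T-linked (i / d) (i % d) (m%n<n i d) (subst (_< N) (m≡m%n+[m/n]*n i d) i<N))

      black-linked : ∀ {u} → Black u → Conn E u (Pv (rankOf u % d))
      black-linked {u} bu with black-vertex bu
      ... | inj₁ (u≡ , r<M) = subst (λ v → Conn E v (Pv (rankOf u % d))) (sym u≡)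
                                (prefix-linked _ r<M ◅◅ T-linked-mod _ (<-≤-trans r<M M≤N))
      ... | inj₂ (u≡ , r<N) = subst (λ v → Conn E v (Pv (rankOf u % d))) (sym u≡) (T-linked-mod _ r<N)

      -- Every black vertex is linked to some Pv r with r < d, and each shift rotates these
      -- representatives; rotations compose, so by Bézout the gcd of the shifts rotates them too.
      Rotates : ℕ → Set
      Rotates x = ∀ r → r < d → Conn E (Pv r) (Pv ((r + x) % d))

      private
        [r%d+x]%d : ∀ r x → (r % d + x) % d ≡ (r + x) % d
        [r%d+x]%d r x = trans (%-distribˡ-+ (r % d) x d)
          (trans (cong (λ a → (a + x % d) % d) (m%n%n≡m%n r d)) (sym (%-distribˡ-+ r x d)))

        rotate-twice : ∀ r x y → Conn E (Pv ((r + x) % d)) (Pv (((r + x) % d + y) % d)) →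
          Conn E (Pv ((r + x) % d)) (Pv ((r + (x + y)) % d))
        rotate-twice r x y = subst (λ a → Conn E _ (Pv a)) (trans ([r%d+x]%d (r + x) y) (cong (_% d) (+-assoc r x y)))

      Rotates-0 : Rotates 0
      Rotates-0 r r<d = subst (λ a → Conn E (Pv r) (Pv a)) (sym (trans (cong (_% d) (+-identityʳ r)) (m<n⇒m%n≡m r<d))) ε

      Rotates-+ : ∀ {x y} → Rotates x → Rotates y → Rotates (x + y)
      Rotates-+ {x} {y} rot-x rot-y r r<d = rot-x r r<d ◅◅ rotate-twice r x y (rot-y ((r + x) % d) (m%n<n (r + x) d))

      Rotates-* : ∀ {x} → Rotates x → ∀ a → Rotates (a * x)
      Rotates-* rot-x zero    = Rotates-0
      Rotates-* rot-x (suc a) = Rotates-+ rot-x (Rotates-* rot-x a)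

      Rotates-∸ : ∀ {x y} → Rotates (x + y) → Rotates y → Rotates x
      Rotates-∸ {x} {y} rot-x+y rot-y r r<d =
        rot-x+y r r<d ◅◅ Conn-sym (rotate-twice r x y (rot-y ((r + x) % d) (m%n<n (r + x) d)))

      Rotates-gcd : ∀ {x y} → Rotates x → Rotates y → Rotates (gcd x y)
      Rotates-gcd {x} {y} rot-x rot-y with Bézout.identity (gcd-GCD x y)
      ... | Bézout.+- a b eq = Rotates-∸ (subst Rotates (sym eq) (Rotates-* rot-x a)) (Rotates-* rot-y b)
      ... | Bézout.-+ a b eq = Rotates-∸ (subst Rotates (sym eq) (Rotates-* rot-y b)) (Rotates-* rot-x a)

      Rotates-shift : ∀ {X} → X ∈ S → Rotates (shift X)
      Rotates-shift X∈S r r<d = proj₁ (linked X∈S r r<M) ◅◅ T-linked-mod _ (proj₂ (linked X∈S r r<M))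
        where r<M = ≤-trans r<d d≤M

      gcdShifts : List Alignment → ℕ
      gcdShifts = foldr (λ X g → gcd (shift X) g) 0

      gcdShifts-∣ : ∀ {L X} → X ∈ L → gcdShifts L ∣ shift X
      gcdShifts-∣ {X ∷ L} (here refl) = gcd[m,n]∣m _ _
      gcdShifts-∣ {X ∷ L} (there X'∈L) = ∣-trans (gcd[m,n]∣n (shift X) (gcdShifts L)) (gcdShifts-∣ X'∈L)

      Rotates-gcdShifts : ∀ L → (∀ {X} → X ∈ L → X ∈ S) → Rotates (gcdShifts L)
      Rotates-gcdShifts []      _    = Rotates-0
      Rotates-gcdShifts (X ∷ L) L⊆S = Rotates-gcd (Rotates-shift (L⊆S (here refl))) (Rotates-gcdShifts L (L⊆S ∘′ there))

      g : ℕ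
      g = gcdShifts S

      instance
        g≢0 : NonZero g
        g≢0 = ≢-nonZero λ g≡0 → ≢-nonZero⁻¹ d (0∣⇒≡0 (subst (_∣ d) g≡0 (gcdShifts-∣ Xsuf∈S)))

      ≡-mod-g⇒Conn : ∀ {r₁ r₂} → r₁ ≤ r₂ → r₂ < d → r₁ % g ≡ r₂ % g → Conn E (Pv r₁) (Pv r₂)
      ≡-mod-g⇒Conn {r₁} {r₂} r₁≤r₂ r₂<d eq
        with m%n≡[m+o]%n⇒n∣o r₁ (r₂ ∸ r₁) g (trans eq (cong (_% g) (sym (m+[n∸m]≡n r₁≤r₂))))
      ... | divides c r₂∸r₁≡c*g = subst (λ r → Conn E (Pv r₁) (Pv r)) lands
              (Rotates-* (Rotates-gcdShifts S id) c r₁ (≤-<-trans r₁≤r₂ r₂<d))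
        where
        lands : (r₁ + c * g) % d ≡ r₂
        lands = trans (cong (λ x → (r₁ + x) % d) (sym r₂∸r₁≡c*g))
                      (trans (cong (_% d) (m+[n∸m]≡n r₁≤r₂)) (m<n⇒m%n≡m r₂<d))

      residueClasses : ResidueClasses g
      residueClasses = record
        { q∣shifts   = gcdShifts-∣
        ; ≡-mod⇒Conn = ≡-mod⇒Conn'
        ; q≤M        = ≤-trans (∣⇒≤ (gcdShifts-∣ Xsuf∈S)) d≤M
        }
        where
        mod-d-mod-g : ∀ x → x % d % g ≡ x % g
        mod-d-mod-g x = m∣n⇒o%n%m≡o%m g d x (gcdShifts-∣ Xsuf∈S)

        ≡-mod⇒Conn' : ∀ {u v} → Black u → Black v → rankOf u % g ≡ rankOf v % g → Conn E u v
        ≡-mod⇒Conn' {u} {v} bu bv eq with ≤-total (rankOf u % d) (rankOf v % d)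
        ... | inj₁ u≤v = black-linked bu ◅◅ ≡-mod-g⇒Conn u≤v (m%n<n _ d) eq' ◅◅ Conn-sym (black-linked bv)
          where eq' = trans (mod-d-mod-g (rankOf u)) (trans eq (sym (mod-d-mod-g (rankOf v))))
        ... | inj₂ v≤u = black-linked bu ◅◅ Conn-sym (≡-mod-g⇒Conn v≤u (m%n<n _ d) eq') ◅◅ Conn-sym (black-linked bv)
          where eq' = trans (mod-d-mod-g (rankOf v)) (trans (sym eq) (sym (mod-d-mod-g (rankOf u))))

    module Unshifted (d≡0 : d ≡ 0) {{_ : NonZero M}} where

      N≡M : N ≡ M
      N≡M = trans (sym M+d≡N) (trans (cong (λ x → M + x) d≡0) (+-identityʳ M))

      shift≡0 : ∀ {X} → X ∈ S → shift X ≡ 0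
      shift≡0 {X} X∈S = n≤0⇒n≡0 (+-cancelˡ-≤ M _ 0
        (subst (M + shift X ≤_) (trans N≡M (sym (+-identityʳ M))) (shift-bound X∈S)))

      black-linked : ∀ {u} → Black u → Conn E u (Pv (rankOf u)) × rankOf u < M
      black-linked {u} bu with black-vertex bu
      ... | inj₁ (u≡ , r<M) = subst (λ v → Conn E v (Pv (rankOf u))) (sym u≡) ε , r<M
      ... | inj₂ (u≡ , r<N) = subst (λ v → Conn E v (Pv (rankOf u))) (sym u≡) (Conn-sym (prefix-linked _ r<M)) , r<M
        where r<M = subst (rankOf u <_) N≡M r<N

      residueClasses : ResidueClasses M
      residueClasses = record
        { q∣shifts   = λ X∈S → subst (M ∣_) (sym (shift≡0 X∈S)) (M ∣0)
        ; ≡-mod⇒Conn = ≡-mod⇒Conn'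
        ; q≤M        = ≤-refl
        }
        where
        ≡-mod⇒Conn' : ∀ {u v} → Black u → Black v → rankOf u % M ≡ rankOf v % M → Conn E u v
        ≡-mod⇒Conn' {u} {v} bu bv eq with black-linked bu | black-linked bv
        ... | u~ , u<M | v~ , v<M = u~ ◅◅ subst (λ r → Conn E (Pv r) v) (sym same) (Conn-sym v~)
          where same = trans (sym (m<n⇒m%n≡m u<M)) (trans eq (m<n⇒m%n≡m v<M))

    residueClasses : NonZero M → Σ ℕ ResidueClasses
    residueClasses M≢0 with d ≟ 0
    ... | yes d≡0 = M , Unshifted.residueClasses d≡0 {{M≢0}}
    ... | no  d≢0 = Periodic.g {{≢-nonZero d≢0}} , Periodic.residueClasses {{≢-nonZero d≢0}}

    bc≡modulus : ∀ {b q} → ResidueClasses q → BC P T E b → b ≡ q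
    bc≡modulus {q = q} classes (reps , refl , reps-black , unrelated , covers) =
      representatives-length (Conn⇒≡-mod q q∣shifts ∘′ proj₂)
        (λ r r<q → Pv r , Pv-black r (≤-trans r<q q≤M) , rankOf-Pv r (≤-trans r<q q≤M))
        reps (reps-black _) unrelated (λ (v-vertex , v-black) → covers _ v-vertex v-black)
      where
      open ResidueClasses classes
      open ClassCounting (Conn E) Conn-sym _◅◅_ Black rankOf q ≡-mod⇒Conn

    black⇒M≢0 : ∀ {u} → Black u → NonZero M
    black⇒M≢0 bu with black-vertex bu
    ... | inj₁ (_ , r<M) = >-nonZero (≤-<-trans z≤n r<M)
    ... | inj₂ (_ , r<N) = half (<-≤-trans (≤-<-trans z≤n r<N) (subst (_≤ M + M) M+d≡N (+-monoʳ-≤ M d≤M)))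
      where
      half : ∀ {m} → 0 < m + m → NonZero m
      half {suc m} _ = _

    bc-residueClasses : ∀ {b} → BC P T E b → 0 < b → ResidueClasses b
    bc-residueClasses ([] , refl , _) ()
    bc-residueClasses bc@(r ∷ _ , _ , reps-black , _) _ with residueClasses (black⇒M≢0 (reps-black r (here refl)))
    ... | _ , classes = subst ResidueClasses (sym (bc≡modulus classes bc)) classes

    module NewAlignment {b : ℕ} (classes : ResidueClasses b)
      (wS : ℕ → ℕ) (covering : Covers eq P T b ps ts wS) (w : ℕ) (weight≤w : sum (map wS (upTo b)) ≤ w)
      (Y : Alignment) (t t' : ℕ) (Y-aligns : AlignPT eq k P T t t' Y)
      (far : ∀ i → i + cnt ps b 0 ≤ cnt ts b 0 → w + 2 * k < ∣ + posAt ts b 0 i - + t - + posAt ps b 0 0 ∣) where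

      open ResidueClasses classes

      E' : List Edge
      E' = graphEdges eq P T (Y ∷ S)

      E⊆E' : E ⊆ E'
      E⊆E' = xs⊆ys++xs E (alignmentEdges eq P T Y)

      Y⊆E' : alignmentEdges eq P T Y ⊆ E'
      Y⊆E' = xs⊆xs++ys (alignmentEdges eq P T Y) E

      record ClassImage (c j : ℕ) : Set where
        field
          position : ℕ
          aligned  : edge (Pv (c + j * b)) (tv position) true ∈ alignmentEdges eq P T Y
          ∈ts      : position ∈ ts
          in-class : rank ts position % b ≡ c

      module ClassPreserving {c} (c<b : c < b) (image : ∀ j → c + j * b < M → ClassImage c j) where

        open ClassImage

        private
          c+0<M : c + 0 * b < M
          c+0<M = subst (_< M) (sym (+-identityʳ c)) (<-≤-trans c<b q≤M)

          y₀ : ℕ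
          y₀ = position (image 0 c+0<M)

          y₀∈ts : y₀ ∈ ts
          y₀∈ts = ∈ts (image 0 c+0<M)

          i : ℕ
          i = rank ts y₀ / b

          rank-y₀ : rank ts y₀ ≡ c + i * b
          rank-y₀ = trans (m≡m%n+[m/n]*n (rank ts y₀) b) (cong (_+ i * b) (in-class (image 0 c+0<M)))

        images-spread : ∀ j (c+jb<M : c + j * b < M) → rank ts y₀ + j * b ≤ rank ts (position (image j c+jb<M))
        images-spread zero c+0b<M = ≤-reflexive (trans (+-identityʳ _) (cong (rank ts)
          (edgesFrom-functional (steps Y) (sx Y) (sy Y) (aligned (image 0 c+0<M)) (aligned (image 0 c+0b<M)))))
        images-spread (suc j) c+[1+j]b<M = begin
          rank ts y₀ + suc j * b         ≡⟨ cong (λ x → rank ts y₀ + x) (+-comm b (j * b)) ⟩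
          rank ts y₀ + (j * b + b)       ≡⟨ +-assoc (rank ts y₀) (j * b) b ⟨
          rank ts y₀ + j * b + b         ≤⟨ +-monoˡ-≤ b (images-spread j c+jb<M) ⟩
          rank ts yⱼ + b                 ≤⟨ %-≡⇒+-≤ b (rank-strictMono ts-sorted yⱼ∈ts yⱼ<yⱼ₊₁) same-class ⟩
          rank ts yⱼ₊₁                   ∎
          where
          open ≤-Reasoning
          c+jb<M = ≤-<-trans (+-monoʳ-≤ c (m≤n+m (j * b) b)) c+[1+j]b<M
          imageⱼ = image j c+jb<M
          imageⱼ₊₁ = image (suc j) c+[1+j]b<M
          yⱼ = position imageⱼ
          yⱼ₊₁ = position imageⱼ₊₁
          yⱼ∈ts = ∈ts imageⱼ
          yⱼ<yⱼ₊₁ : yⱼ < yⱼ₊₁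
          yⱼ<yⱼ₊₁ = edgesFrom-strictMono (steps Y) (sx Y) (sy Y) (aligned imageⱼ) (aligned imageⱼ₊₁)
                      (nth-strictMono ps-sorted (+-monoʳ-< c (m<n+m (j * b) (>-nonZero⁻¹ b))) c+[1+j]b<M)
          same-class : rank ts yⱼ % b ≡ rank ts yⱼ₊₁ % b
          same-class = trans (in-class imageⱼ) (sym (in-class imageⱼ₊₁))

        private
          e : ℕ
          e = _∣_.quotient (q∣shifts Xsuf∈S)

          N≡M+e*b : N ≡ M + e * b
          N≡M+e*b = trans (sym M+d≡N) (cong (λ x → M + x) (_∣_.equality (q∣shifts Xsuf∈S)))

        i+m₀≤n₀ : i + cnt ps b 0 ≤ cnt ts b 0
        i+m₀≤n₀ with last-of-residue c M b (<-≤-trans c<b q≤M)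
        ... | j , c+jb<M , M≤c+b+jb = begin
          i + ceilDiv M b            ≤⟨ +-monoˡ-≤ (ceilDiv M b) i≤e ⟩
          e + ceilDiv M b            ≡⟨ +-comm e (ceilDiv M b) ⟩
          ceilDiv M b + e            ≡⟨ ceilDiv-+* M e b ⟨
          ceilDiv (M + e * b) b      ≡⟨ cong (λ n → ceilDiv n b) N≡M+e*b ⟨
          ceilDiv N b                ∎
          where
          open ≤-Reasoning
          i≤e : i ≤ e
          i≤e = index-bound c i j b e M (subst₂ (λ r n → r + j * b < n) rank-y₀ N≡M+e*b
            (≤-<-trans (images-spread j c+jb<M) (rank-<-length ts-sorted (∈ts (image j c+jb<M))))) M≤c+b+jb

        private
          π τ : ℕ → ℕ
          π c' = posAt ps b c' 0
          τ c' = posAt ts b c' i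

          offset : ℕ → ℤ
          offset c' = + π c' - + τ c'

          τ-c : τ c ≡ y₀
          τ-c = trans (cong (nth ts) (sym rank-y₀)) (nth-rank ts-sorted y₀∈ts)

        offset-step : ∀ c' → c' < c → ∣ offset (suc c') - offset c' ∣ ≤ wS c'
        offset-step c' c'<c = subst (_≤ wS c') (cong ∣_∣ (regroup (+ π c') (+ π (suc c')) (+ τ c') (+ τ (suc c'))))
          (EDle⇒∣offset-offset∣≤ eq (Covers.cover1 covering c' (<-trans c'<c c<b) 0 0<m₍c'+1₎ i i<n₍c'+1₎))
          where
          regroup : ∀ (p p' q q' : ℤ) → (p' - p) - (q' - q) ≡ (p' - q') - (p - q)
          regroup = solve-∀
          0<m₍c'+1₎ : 0 < cnt ps b (suc c')
          0<m₍c'+1₎ = *<⇒<ceilDiv 0 (M ∸ suc c') b (m<n⇒0<n∸m (≤-<-trans c'<c (<-≤-trans c<b q≤M)))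
          i<n₍c'+1₎ : i < cnt ts b (suc c')
          i<n₍c'+1₎ = *<⇒<ceilDiv i (N ∸ suc c') b (m+n≤o⇒m≤o∸n (suc (i * b)) (begin
            suc (i * b) + suc c'    ≡⟨ +-comm (suc (i * b)) (suc c') ⟩
            suc c' + suc (i * b)    ≡⟨ +-suc (suc c') (i * b) ⟩
            suc (suc c' + i * b)    ≤⟨ s≤s (+-monoˡ-≤ (i * b) c'<c) ⟩
            suc (c + i * b)         ≡⟨ cong suc rank-y₀ ⟨
            suc (rank ts y₀)        ≤⟨ rank-<-length ts-sorted y₀∈ts ⟩
            N                       ∎))
            where open ≤-Reasoning

        Y-offset : ∣ (+ π c - + 0) - (+ τ c - + t) ∣ ≤ k
        Y-offset = let ((sx≡0 , _) , (sy≡t , _)) , _ , cost≤k = Y-aligns in begin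
          ∣ (+ π c - + 0) - (+ τ c - + t) ∣        ≡⟨ cong₂ (λ x y → ∣ (+ π c - + x) - (+ τ c - + y) ∣) sx≡0 sy≡t ⟨
          ∣ (+ π c - + sx Y) - (+ τ c - + sy Y) ∣  ≡⟨ cong (λ y → ∣ (+ π c - + sx Y) - (+ y - + sy Y) ∣) τ-c ⟩
          ∣ (+ π c - + sx Y) - (+ y₀ - + sy Y) ∣   ≤⟨ EDle⇒∣offset-offset∣≤ eq prefix-to-y₀ ⟩
          cost eq P T Y                            ≤⟨ cost≤k ⟩
          k                                        ∎
          where
          open ≤-Reasoning
          prefix-to-y₀ = edgesFrom-prefix (steps Y) (sx Y) (sy Y) (aligned (image 0 c+0<M))

        absurd : ⊥
        absurd = <⇒≱ (far i i+m₀≤n₀) (begin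
          ∣ + τ 0 - + t - + π 0 ∣                   ≤⟨ offsets-combine {π 0} {τ 0} {π c} {τ c} {t} telescoped Y-offset ⟩
          w + k                                     ≤⟨ +-monoʳ-≤ w (m≤m+n k (k + 0)) ⟩
          w + 2 * k                                 ∎)
          where
          open ≤-Reasoning
          telescoped : ∣ offset c - offset 0 ∣ ≤ w
          telescoped = ≤-trans (telescope offset wS c offset-step) (≤-trans (sum-upTo-mono wS (<⇒≤ c<b)) weight≤w)

      open ClassCounting (Conn E') Conn-sym _◅◅_ Black rankOf b (λ bu bv same → Conn-mono E⊆E' (≡-mod⇒Conn bu bv same))

      splits-classes : ∀ {r'} → IsVertex P T r' → InBlack E' r' → ¬ ¬ SplitsClasses r'
      splits-classes {r'} r'-vertex r'-black no-split = ClassPreserving.absurd (m%n<n (rankOf r') b) image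
        where
        c = rankOf r' % b
        r'-old : Black r'
        r'-old = r'-vertex , InBlack-antitone E⊆E' r'-black

        r'~Pv : ∀ j → c + j * b < M → Conn E' r' (Pv (c + j * b))
        r'~Pv j c+jb<M = Conn-mono E⊆E' (≡-mod⇒Conn r'-old (Pv-black _ c+jb<M) (sym (begin
          rankOf (Pv (c + j * b)) % b   ≡⟨ cong (_% b) (rankOf-Pv _ c+jb<M) ⟩
          (c + j * b) % b               ≡⟨ [m+kn]%n≡m%n c j b ⟩
          c % b                         ≡⟨ m%n%n≡m%n (rankOf r') b ⟩
          c                             ∎)))
          where open ≡-Reasoning

        image : ∀ j → c + j * b < M → ClassImage c j
        image j c+jb<M with edgesFrom-covers (steps Y) (sx Y) (sy Y) x sx≤x x<ex
          where
          x = nth ps (c + j * b)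
          sx≤x = subst (_≤ x) (sym (proj₁ (proj₁ (proj₁ Y-aligns)))) z≤n
          x<ex = subst (x <_) (sym (proj₂ (proj₁ (proj₁ Y-aligns)))) (proj₁ (∈ps⇒black (nth-∈ ps c+jb<M)))
        ... | inj₂ e = ⊥-elim (InBlack⇒¬Conn-red r'-black (Y⊆E' e) (r'~Pv j c+jb<M))
        ... | inj₁ (_ , false , e , _) = ⊥-elim (InBlack⇒¬Conn-red r'-black (Y⊆E' e) (r'~Pv j c+jb<M))
        ... | inj₁ (y' , true , e , y'<ey) = record
          { position = y' ; aligned = e ; ∈ts = black⇒∈ts y'<|T| y'-black ; in-class = same-class }
          where
          r'~y' : Conn E' r' (tv y')
          r'~y' = r'~Pv j c+jb<M ◅◅ edge⇒Conn (Y⊆E' e)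
          y'-black : InBlack E (tv y')
          y'-black = InBlack-antitone E⊆E' (InBlack-Conn r'-black r'~y' λ ())
          y'<|T| : y' < length T
          y'<|T| = let (_ , (_ , ey≡t')) , t'≤|T| , _ = Y-aligns in <-≤-trans y'<ey (≤-trans (≤-reflexive ey≡t') t'≤|T|)
          same-class : rank ts y' % b ≡ c
          same-class = decidable-stable (rank ts y' % b ≟ c) λ differ → no-split record
            { u-black = r'-old ; v-black = y'<|T| , y'-black ; r~u = ε ; r~v = r'~y'
            ; classes-differ = differ ∘′ sym }

      bc-halves : ∀ {b'} → BC P T E' b' → b' ≤ b / 2
      bc-halves (reps , refl , reps-black , unrelated , _) = m*n≤o⇒m≤o/n (length reps) 2 b
        (subst (_≤ b) (*-comm 2 (length reps)) (splitting-representatives-length reps unrelated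
          λ {r} r∈ → splits-classes (proj₁ (reps-black r r∈)) (proj₂ (reps-black r r∈))))

lemma4p18 : {A : Set} (eq : DecidableEquality A) (k w : ℕ) (P T : List A)
  (S : List Alignment) →
  -- every alignment of S aligns P onto some fragment of T with cost ≤ k
  (∀ a → a ∈ S → Σ ℕ λ u → Σ ℕ λ u' → AlignPT eq k P T u u' a) →
  -- S encloses T
  length T + 2 * k ≤ 2 * length P →
  (Xpref : Alignment) → Xpref ∈ S → sy Xpref ≡ 0 →
  (Xsuf : Alignment) → Xsuf ∈ S → ey Xsuf ≡ length T →
  -- b = bc(G_S) > 0
  (b : ℕ) → BC P T (graphEdges eq P T S) b → 0 < b →
  -- ps = P_{|S}, ts = T_{|S} (as position lists)
  (ps ts : List ℕ) →
  BlackPositionsP P T (graphEdges eq P T S) ps →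
  BlackPositionsT P T (graphEdges eq P T S) ts →
  -- a covering weight function of total weight ≤ w
  (wS : ℕ → ℕ) → Covers eq P T b ps ts wS → sum (map wS (upTo b)) ≤ w →
  -- the alignment Y of P onto T[t..t') of cost ≤ k
  (Y : Alignment) (t t' : ℕ) → AlignPT eq k P T t t' Y →
  (∀ i → i + cnt ps b 0 ≤ cnt ts b 0 →
     w + 2 * k < ∣ + posAt ts b 0 i - + t - + posAt ps b 0 0 ∣) →
  (b' : ℕ) → BC P T (graphEdges eq P T (Y ∷ S)) b' →
  b' ≤ b / 2
lemma4p18 eq k w P T S S-aligns encloses Xpref Xpref∈S Xpref-start Xsuf Xsuf∈S Xsuf-end
  b bc 0<b ps ts blackP blackT wS covering weight≤w Y t t' Y-aligns far b' bc' =
  NewAlignment.bc-halves (bc-residueClasses bc 0<b) wS covering w weight≤w Y t t' Y-aligns far bc'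
  where
  open Components eq k P T S S-aligns ps ts blackP blackT
  open Enclosed encloses Xpref Xpref∈S Xpref-start Xsuf Xsuf∈S Xsuf-end
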